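{- Let $G$ be a complete multi-partite graph of order $n$ with at least two partite sets, let $2\le q\le n-1$, and let $H\in\mathcal{M}_q(G)$ be such that $or_1(H)\ge or_1(H')$ for every $H'\in\mathcal{M}_q(G)$. Then: (i) $or_1(H)+or_3(H)=q$; (ii) if moreover $\mathrm{seq}(H)\succeq\mathrm{seq}(H')$ for every $H'\in\mathcal{M}_q(G)$, then $\mathrm{seq}(H)$ is either of the form $(h_1,\underbrace{h_2,\dots,h_2}_{t},h_3)$ with $t\ge 1$, $h_1\ge h_2\ge h_3$, and $h_3=h_2$ when $t=1$; or of the form $(h_1,\underbrace{h_2,\dots,h_2}_{t_1},\underbrace{1,\dots,1}_{t_2})$ with $t_1,t_2\ge 2$ and $h_1\ge h_2\ge 2$.
   Context: For a graph $H$ with components $H_1,\dots,H_s$ ($s=com(H)$ the number of components) ordered so that $|V(H_1)|\ge\dots\ge|V(H_s)|$, write $or_i(H)=|V(H_i)|$ and $\mathrm{seq}(H)=(or_1(H),\dots,or_s(H))$. $\mathcal{S}_q(G)$ is the set of disconnected spanning subgraphs $H$ of $G$ with $or_1(H)+or_2(H)\le q$; $\ell_q(G)$ is the maximum number of edges of a member of $\mathcal{S}_q(G)$, and $\mathcal{M}_q(G)$ is the set of members of $\mathcal{S}_q(G)$ with exactly $\ell_q(G)$ edges. For finite sequences, $(a_1,\dots,a_s)\succeq(b_1,\dots,b_t)$ means either $s=t$ and $a_i=b_i$ for all $i$, or there is $i\le\min\{s,t\}$ with $a_i>b_i$ and $a_j=b_j$ for all $j<i$ (lexicographic order). -}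

module Defs where

open import Data.Nat using (ℕ; zero; suc; _+_; _≤_; _<_; _≥_; _>_; _<ᵇ_)
open import Data.Bool using (Bool; true; false; _∧_)
open import Data.Fin using (Fin; toℕ)
open import Data.Fin.Properties using (_≟_)
open import Data.List using (List; []; _∷_; _++_; length; map; filterᵇ; cartesianProduct; replicate; [_])
open import Data.List.Relation.Unary.Linked using (Linked)
open import Data.List using () renaming (allFin to allFinL)
open import Data.Product using (Σ; ∃; _×_; _,_; proj₁)
open import Function.Bundles using (_⇔_)
open import Relation.Binary.PropositionalEquality using (_≡_; _≢_)
open import Relation.Nullary.Decidable using (⌊_⌋)

-- Complete multipartite graph of order n with k partite sets:
-- vertices Fin n, `part : Fin n → Fin k` assigns each vertex its partite
-- set; u,v adjacent iff part u ≢ part v.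

record CompleteMultipartite (n : ℕ) : Set where
  field
    k        : ℕ
    part     : Fin n → Fin k
    part-surj : ∀ (i : Fin k) → ∃ λ (u : Fin n) → part u ≡ i

open CompleteMultipartite public

record SpanningSubgraph {n : ℕ} (G : CompleteMultipartite n) : Set where
  field
    adj     : Fin n → Fin n → Bool
    adj-sym : ∀ u v → adj u v ≡ adj v u
    adj-sub : ∀ u v → adj u v ≡ true → part G u ≢ part G v

open SpanningSubgraph public

edges : ∀ {n} {G : CompleteMultipartite n} → SpanningSubgraph G → ℕ
edges {n} H =
  length (filterᵇ (λ p → (toℕ (Data.Product.proj₁ p) <ᵇ toℕ (Data.Product.proj₂ p)) ∧ adj H (Data.Product.proj₁ p) (Data.Product.proj₂ p))
                  (cartesianProduct (allFinL n) (allFinL n)))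

data Reach {n} {G : CompleteMultipartite n} (H : SpanningSubgraph G) (u : Fin n) : Fin n → Set where
  here : Reach H u u
  step : ∀ {v w} → Reach H u v → adj H v w ≡ true → Reach H u w

classSize : ∀ {n s} → (Fin n → Fin s) → Fin s → ℕ
classSize {n} c i = length (filterᵇ (λ u → ⌊ c u ≟ i ⌋) (allFinL n))

-- IsSeq H xs : xs = seq(H), the component orders listed non-increasingly.
IsSeq : ∀ {n} {G : CompleteMultipartite n} → SpanningSubgraph G → List ℕ → Set
IsSeq {n} H xs =
  Σ ℕ λ s → Σ (Fin n → Fin s) λ c →
      (∀ (i : Fin s) → ∃ λ (u : Fin n) → c u ≡ i)
    × (∀ u v → (c u ≡ c v) ⇔ Reach H u v)
    × (xs ≡ map (classSize c) (allFinL s))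
    × Linked _≥_ xs

-- or₁ of a sequence (0 for the empty sequence; never used on it)
or₁ : List ℕ → ℕ
or₁ []      = 0
or₁ (x ∷ _) = x

-- H ∈ 𝒮_q(G): disconnected and or₁ + or₂ ≤ q
InS : ∀ {n} {G : CompleteMultipartite n} → ℕ → SpanningSubgraph G → Set
InS q H = ∃ λ xs → IsSeq H xs × (Σ ℕ λ a → Σ ℕ λ b → Σ (List ℕ) λ r → xs ≡ a ∷ b ∷ r × a + b ≤ q)

InM : ∀ {n} {G : CompleteMultipartite n} → ℕ → SpanningSubgraph G → Set
InM {G = G} q H = InS q H × (∀ (H' : SpanningSubgraph G) → InS q H' → edges H' ≤ edges H)

data _⪰_ : List ℕ → List ℕ → Set where
  ⪰-eq   : ∀ {xs} → xs ⪰ xs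
  ⪰-gt   : ∀ {a b xs ys} → a > b → (a ∷ xs) ⪰ (b ∷ ys)
  ⪰-cons : ∀ {a xs ys} → xs ⪰ ys → (a ∷ xs) ⪰ (a ∷ ys)

ShapeA : List ℕ → Set
ShapeA xs = Σ ℕ λ h₁ → Σ ℕ λ h₂ → Σ ℕ λ h₃ → Σ ℕ λ t →
  (xs ≡ h₁ ∷ (replicate t h₂ ++ [ h₃ ])) × t ≥ 1 × h₁ ≥ h₂ × h₂ ≥ h₃ × (t ≡ 1 → h₃ ≡ h₂)

ShapeB : List ℕ → Set
ShapeB xs = Σ ℕ λ h₁ → Σ ℕ λ h₂ → Σ ℕ λ t₁ → Σ ℕ λ t₂ →
  (xs ≡ h₁ ∷ (replicate t₁ h₂ ++ replicate t₂ 1)) × t₁ ≥ 2 × t₂ ≥ 2 × h₁ ≥ h₂ × h₂ ≥ 2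

-- Let H ∈ ℳ_q(G) have components of orders A ≥ B ≥ C ≥ ⋯, and label every vertex by its
-- component.  H lies inside the graph ⟪ c ⟫ that keeps exactly the edges of G within components.
-- Moving one vertex v from a component Y to a component X gives the graph ⟪ c′ ⟫ for the new
-- labelling c′, and this loses no edges as soon as v has at least as many G-neighbours in X as in
-- Y; when |Y| ≤ |X|, averaging over the parts of G finds such a v.  If |X| ≥ 2, or X and Y are
-- singletons in different parts, then v stays connected to X, so the move enlarges X by one.
-- (i) If A + C < q, enlarging the largest component in this way yields a member of ℳ_q(G) with
-- or₁ = A + 1.
-- (ii) Then A + C = q ≥ A + B, so B = C.  A sequence (A, B, B, …) of neither shape has two
-- consecutive orders z ≥ z′ with 2 ≤ z < B; moving a vertex from the z′-component to the
-- z-component yields a member of ℳ_q(G) with lexicographically larger sequence.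

module Submission where

open import Defs
open import Data.Nat using (ℕ; _<ᵇ_; zero; suc; _+_; _*_; _∸_; _≤_; _<_; _≥_; z≤n; s≤s; s≤s⁻¹; _≤?_; _<?_; _≤ᵇ_)
open import Data.Nat.Properties hiding (_≟_; ≡ᵇ⇒≡; suc-injective)
open import Data.Bool using (Bool; true; false; _∧_; not; if_then_else_)
open import Data.Fin using (Fin; toℕ; fromℕ<) renaming (zero to fz; suc to fs)
open import Data.Fin.Properties using (_≟_; toℕ-injective; toℕ<n; toℕ-fromℕ<; any?; all?; ¬∀⟶∃¬; suc-injective)
open import Data.List using (List; []; _∷_; _++_; [_]; length; map; filterᵇ; cartesianProduct; cartesianProductWith; tabulate; allFin; lookup; replicate; deduplicate)
open import Data.List.Properties using (tabulate-lookup; tabulate-cong; map-tabulate; ++-identityʳ; ∷-injective)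
open import Data.List.Relation.Unary.All using (All; []; _∷_)
open import Data.List.Relation.Unary.Any using (Any; index)
open import Data.List.Relation.Unary.AllPairs using (AllPairs; []; _∷_)
open import Data.List.Relation.Unary.Linked using (Linked; []; [-]; _∷_)
open import Data.Product using (Σ; ∃; ∃-syntax; _×_; _,_; proj₁; proj₂)
open import Data.Sum using (_⊎_; inj₁; inj₂)
open import Data.Empty using (⊥; ⊥-elim)
open import Data.Vec.Functional using (Vector)
open import Function using (_∘_; id; _on_; case_of_)
open import Function.Bundles using (_⇔_; mk⇔; Equivalence)
open import Relation.Binary.PropositionalEquality hiding ([_])
open import Relation.Nullary using (¬_; Dec; yes; no; does; contradiction)
open import Relation.Nullary.Decidable using (⌊_⌋; map′; dec-true; dec-false; isYes≗does; does-⇔; _⊎-dec_; _×-dec_; _→-dec_)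
open import Algebra.Properties.Semiring.Sum +-*-semiring using (sum; sum-syntax; sum-cong-≗; ∑-distrib-+; ∑-comm; *-distribˡ-sum; *-distribʳ-sum; sum-replicate-zero)
open import Algebra.Properties.CommutativeSemigroup +-commutativeSemigroup using (x∙yz≈y∙xz; xy∙z≈zy∙x)
open import Data.Bool.Properties using (∧-zeroʳ) renaming (_≟_ to _≟ᵇ_)
open import Data.List.Relation.Unary.Linked.Properties using (AllPairs⇒Linked; Linked⇒AllPairs)
import Data.List.Relation.Unary.Linked.Properties as Linked
import Data.List.Relation.Unary.All as All
import Data.List.Relation.Unary.All.Properties as Allₚ
import Data.List.Relation.Unary.AllPairs.Properties as AllPairsₚ
import Data.List.Relation.Unary.Any as Any
open import Data.List.Relation.Unary.Any.Properties using (lookup-index)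
open import Data.List.Relation.Binary.Permutation.Propositional using (_↭_; ↭-refl; ↭-prep; ↭-swap; ↭-trans; ↭-sym)
open import Data.List.Relation.Binary.Permutation.Propositional.Properties using (Any-resp-↭)
open import Data.List.Membership.Propositional.Properties using (∈-allFin; ∈-lookup)
open import Data.List.Membership.Setoid.Properties using (∈-deduplicate⁺)
open import Data.List.Relation.Unary.Unique.DecSetoid.Properties using (deduplicate-!)
open import Relation.Binary.Bundles using (DecSetoid)
open import Relation.Binary.Definitions using (tri<; tri≈; tri>)
open import Data.Nat.Solver using (module +-*-Solver)
open +-*-Solver using (solve; _:=_; _:+_; _:*_)

⟦_⟧ : Bool → ℕ
⟦ true ⟧ = 1
⟦ false ⟧ = 0

⟦⟧≤1 : ∀ b → ⟦ b ⟧ ≤ 1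
⟦⟧≤1 true = ≤-refl
⟦⟧≤1 false = z≤n

⟦∧⟧ : ∀ a b → ⟦ a ∧ b ⟧ ≡ ⟦ a ⟧ * ⟦ b ⟧
⟦∧⟧ true b = sym (+-identityʳ ⟦ b ⟧)
⟦∧⟧ false b = refl

∧-true : ∀ a {b} → a ∧ b ≡ true → a ≡ true × b ≡ true
∧-true true b≡true = refl , b≡true

⟦⟧-mono : ∀ {a b} → (a ≡ true → b ≡ true) → ⟦ a ⟧ ≤ ⟦ b ⟧
⟦⟧-mono {false} _ = z≤n
⟦⟧-mono {true} a⇒b rewrite a⇒b refl = ≤-refl

dec-true⁻ : ∀ {A : Set} (a? : Dec A) → does a? ≡ true → A
dec-true⁻ (yes a) _ = a

⟦does⟧-mono : ∀ {A B : Set} → (A → B) → (a? : Dec A) (b? : Dec B) → ⟦ does a? ⟧ ≤ ⟦ does b? ⟧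
⟦does⟧-mono f a? b? = ⟦⟧-mono (dec-true b? ∘ f ∘ dec-true⁻ a?)

⟦does⟧-< : ∀ {A B : Set} (a? : Dec A) (b? : Dec B) → ¬ A → B → ⟦ does a? ⟧ < ⟦ does b? ⟧
⟦does⟧-< a? b? ¬a b rewrite dec-false a? ¬a | dec-true b? b = s≤s z≤n

_≡ᵇ_ : ∀ {n} → Fin n → Fin n → Bool
a ≡ᵇ b = does (a ≟ b)

≡ᵇ-refl : ∀ {n} (a : Fin n) → (a ≡ᵇ a) ≡ true
≡ᵇ-refl a = dec-true (a ≟ a) refl

≡ᵇ⇒≡ : ∀ {n} {a b : Fin n} → (a ≡ᵇ b) ≡ true → a ≡ b
≡ᵇ⇒≡ {a = a} {b} eq with a ≟ b
... | yes a≡b = a≡b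

≢⇒≡ᵇ-false : ∀ {n} {a b : Fin n} → a ≢ b → (a ≡ᵇ b) ≡ false
≢⇒≡ᵇ-false {a = a} {b} = dec-false (a ≟ b)

≡ᵇ-sym : ∀ {n} (a b : Fin n) → (a ≡ᵇ b) ≡ (b ≡ᵇ a)
≡ᵇ-sym a b = does-⇔ (mk⇔ sym sym) (a ≟ b) (b ≟ a)

∑-mono-≤ : ∀ {n} {f g : Vector ℕ n} → (∀ i → f i ≤ g i) → sum f ≤ sum g
∑-mono-≤ {zero} f≤g = z≤n
∑-mono-≤ {suc n} f≤g = +-mono-≤ (f≤g fz) (∑-mono-≤ (f≤g ∘ fs))

∑-zero : ∀ {n} {f : Vector ℕ n} → (∀ i → f i ≡ 0) → sum f ≡ 0
∑-zero {n} f≡0 = trans (sum-cong-≗ f≡0) (sum-replicate-zero n)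

except : ∀ {n} → Fin n → Vector ℕ n → Vector ℕ n
except v f i = if i ≡ᵇ v then 0 else f i

sum-except : ∀ {n} (f : Vector ℕ n) (v : Fin n) → sum f ≡ f v + sum (except v f)
sum-except f fz = refl
sum-except f (fs v) = begin
  f fz + sum (f ∘ fs)                        ≡⟨ cong (f fz +_) (sum-except (f ∘ fs) v) ⟩
  f fz + (f (fs v) + sum (except v (f ∘ fs))) ≡⟨ x∙yz≈y∙xz (f fz) (f (fs v)) _ ⟩
  f (fs v) + (f fz + sum (except v (f ∘ fs))) ∎
  where open ≡-Reasoning

except-mono-≤ : ∀ {n} {f g : Vector ℕ n} (v : Fin n) → (∀ i → f i ≤ g i) → ∀ i → except v f i ≤ except v g i
except-mono-≤ v f≤g i with i ≡ᵇ v
... | true = z≤n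
... | false = f≤g i

≤-sum : ∀ {n} (f : Vector ℕ n) v → f v ≤ sum f
≤-sum f v = ≤-trans (m≤m+n (f v) _) (≤-reflexive (sym (sum-except f v)))

∑-mono-< : ∀ {n} {f g : Vector ℕ n} → (∀ i → f i ≤ g i) → ∀ v → f v < g v → sum f < sum g
∑-mono-< {f = f} {g} f≤g v fv<gv = begin-strict
  sum f                    ≡⟨ sum-except f v ⟩
  f v + sum (except v f)   <⟨ +-monoˡ-< _ fv<gv ⟩
  g v + sum (except v f)   ≤⟨ +-monoʳ-≤ (g v) (∑-mono-≤ (except-mono-≤ v f≤g)) ⟩
  g v + sum (except v g)   ≡⟨ sum-except g v ⟨
  sum g                    ∎
  where open ≤-Reasoning

∑-point : ∀ {n} (a : Fin n) (g : Vector ℕ n) → ∑[ i < n ] (⟦ a ≡ᵇ i ⟧ * g i) ≡ g a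
∑-point a g = begin
  ∑[ i < _ ] (⟦ a ≡ᵇ i ⟧ * g i)
    ≡⟨ sum-except _ a ⟩
  ⟦ a ≡ᵇ a ⟧ * g a + sum (except a _)
    ≡⟨ cong₂ _+_ (cong (λ b → ⟦ b ⟧ * g a) (≡ᵇ-refl a)) (∑-zero off-a) ⟩
  g a + 0 + 0
    ≡⟨ trans (+-identityʳ _) (+-identityʳ _) ⟩
  g a ∎
  where
  open ≡-Reasoning
  off-a : ∀ i → except a (λ i → ⟦ a ≡ᵇ i ⟧ * g i) i ≡ 0
  off-a i with i ≟ a
  ... | yes _ = refl
  ... | no i≢a rewrite ≢⇒≡ᵇ-false (i≢a ∘ sym) = refl

count : ∀ {n} → (Fin n → Bool) → ℕ
count {n} p = ∑[ i < n ] ⟦ p i ⟧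

count-cong : ∀ {n} {p p′ : Fin n → Bool} → (∀ i → p i ≡ true ⇔ p′ i ≡ true) → count p ≡ count p′
count-cong p⇔p′ = sum-cong-≗ λ i → cong ⟦_⟧ (same-truth (p⇔p′ i))
  where
  same-truth : ∀ {a b} → (a ≡ true ⇔ b ≡ true) → a ≡ b
  same-truth {false} {false} _ = refl
  same-truth {true} {true} _ = refl
  same-truth {true} {false} a⇔b = sym (Equivalence.to a⇔b refl)
  same-truth {false} {true} a⇔b = Equivalence.from a⇔b refl

count-true : ∀ n → count {n} (λ _ → true) ≡ n
count-true zero = refl
count-true (suc n) = cong suc (count-true n)

count≤n : ∀ {n} (p : Fin n → Bool) → count p ≤ n
count≤n {n} p = ≤-trans (∑-mono-≤ (λ i → ⟦⟧≤1 (p i))) (≤-reflexive (count-true n))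

count-witness : ∀ {n} (p : Fin n → Bool) → 1 ≤ count p → ∃[ i ] p i ≡ true
count-witness {suc n} p 1≤count with p fz in eq
... | true = fz , eq
... | false = let (i , pi) = count-witness (p ∘ fs) 1≤count in fs i , pi

count-except : ∀ {n} (p : Fin n → Bool) u → p u ≡ true → count p ≡ suc (count (λ w → not (w ≡ᵇ u) ∧ p w))
count-except p u pu = trans (sum-except _ u) (cong₂ _+_ (cong ⟦_⟧ pu) (sum-cong-≗ off-u))
  where
  off-u : ∀ w → except u (λ w → ⟦ p w ⟧) w ≡ ⟦ not (w ≡ᵇ u) ∧ p w ⟧
  off-u w with w ≡ᵇ u
  ... | true = refl
  ... | false = refl

2≤count : ∀ {n} (p : Fin n → Bool) {u u′} → p u ≡ true → p u′ ≡ true → u ≢ u′ → 2 ≤ count p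
2≤count p {u} {u′} pu pu′ u≢u′ rewrite count-except p u pu = s≤s (≤-trans (≤-reflexive (sym u′-counted)) (≤-sum _ u′))
  where
  u′-counted : ⟦ not (u′ ≡ᵇ u) ∧ p u′ ⟧ ≡ 1
  u′-counted rewrite ≢⇒≡ᵇ-false (u≢u′ ∘ sym) | pu′ = refl

count-two : ∀ {n} (p : Fin n → Bool) → 2 ≤ count p → ∃[ u ] ∃[ u′ ] p u ≡ true × p u′ ≡ true × u ≢ u′
count-two p 2≤count with count-witness p (≤-trans (s≤s z≤n) 2≤count)
... | u , pu with count-witness (λ w → not (w ≡ᵇ u) ∧ p w) (s≤s⁻¹ (subst (2 ≤_) (count-except p u pu) 2≤count))
...   | u′ , q = u , u′ , pu , other u′ q
  where
  other : ∀ w → not (w ≡ᵇ u) ∧ p w ≡ true → p w ≡ true × u ≢ w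
  other w q with w ≟ u
  ... | no w≢u = q , w≢u ∘ sym

-- Reachability

module Reachability {n} {G : CompleteMultipartite n} (H : SpanningSubgraph G) where

  Reach-cons : ∀ {u v w} → adj H u v ≡ true → Reach H v w → Reach H u w
  Reach-cons uv here = step here uv
  Reach-cons uv (step r e) = step (Reach-cons uv r) e

  Reach-trans : ∀ {u v w} → Reach H u v → Reach H v w → Reach H u w
  Reach-trans r here = r
  Reach-trans r (step r′ e) = step (Reach-trans r r′) e

  Reach-sym : ∀ {u v} → Reach H u v → Reach H v u
  Reach-sym here = here
  Reach-sym (step {v} {w} r e) = Reach-cons (trans (adj-sym H w v) e) (Reach-sym r)

  module _ (u : Fin n) where

    Within : ℕ → Fin n → Set
    Within zero w = u ≡ w
    Within (suc k) w = Within k w ⊎ ∃[ v ] Within k v × adj H v w ≡ true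

    within? : ∀ k w → Dec (Within k w)
    within? zero w = u ≟ w
    within? (suc k) w = within? k w ⊎-dec any? (λ v → within? k v ×-dec (adj H v w ≟ᵇ true))

    Within⇒Reach : ∀ {k w} → Within k w → Reach H u w
    Within⇒Reach {zero} refl = here
    Within⇒Reach {suc k} (inj₁ p) = Within⇒Reach p
    Within⇒Reach {suc k} (inj₂ (v , p , e)) = step (Within⇒Reach p) e

    Reach⇒Within : ∀ {w} → Reach H u w → ∃[ k ] Within k w
    Reach⇒Within here = 0 , refl
    Reach⇒Within (step r e) = let (k , p) = Reach⇒Within r in suc k , inj₂ (_ , p , e)

    Within-+ : ∀ m {k w} → Within k w → Within (m + k) w
    Within-+ zero p = p
    Within-+ (suc m) p = inj₁ (Within-+ m p)

    Closed : ℕ → Set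
    Closed k = ∀ w → Within (suc k) w → Within k w

    Closed-stable : ∀ {k} → Closed k → ∀ m {w} → Within (m + k) w → Within k w
    Closed-stable closed zero p = p
    Closed-stable closed (suc m) (inj₁ p) = Closed-stable closed m p
    Closed-stable closed (suc m) (inj₂ (v , p , e)) = closed _ (inj₂ (v , Closed-stable closed m p , e))

    size : ℕ → ℕ
    size k = count (λ w → does (within? k w))

    closed⊎grows : ∀ k → Closed k ⊎ size k < size (suc k)
    closed⊎grows k with all? (λ w → within? (suc k) w →-dec within? k w)
    ... | yes closed = inj₁ closed
    ... | no ¬closed with ¬∀⟶∃¬ n _ (λ w → within? (suc k) w →-dec within? k w) ¬closed
    ...   | w , ¬imp with fresh (within? (suc k) w) ¬imp
      where
      fresh : ∀ {A B : Set} → Dec A → ¬ (A → B) → A × ¬ B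
      fresh (yes a) ¬imp = a , λ b → ¬imp (λ _ → b)
      fresh (no ¬a) ¬imp = contradiction (λ a → contradiction a ¬a) ¬imp
    ...     | new , ¬old = inj₂ (∑-mono-< (λ v → ⟦does⟧-mono inj₁ (within? k v) (within? (suc k) v)) w
                                          (⟦does⟧-< (within? k w) (within? (suc k) w) ¬old new))

    closed⊎large : ∀ k → (∃ Closed) ⊎ k < size k
    closed⊎large zero = inj₂ (≤-trans (≤-reflexive (cong ⟦_⟧ (sym (dec-true (u ≟ u) refl)))) (≤-sum _ u))
    closed⊎large (suc k) with closed⊎large k | closed⊎grows k
    ... | inj₁ c | _ = inj₁ c
    ... | inj₂ _ | inj₁ c = inj₁ (k , c)
    ... | inj₂ k<size | inj₂ grows = inj₂ (≤-trans (s≤s k<size) grows)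

    -- A step that is not closed reaches a new vertex, so a closed step occurs within n steps.
    closure : ∃ Closed
    closure with closed⊎large n
    ... | inj₁ c = c
    ... | inj₂ n<size = contradiction (count≤n _) (<⇒≱ n<size)

    -- Opaque, so that `with reach? u w` can abstract over it in later proofs.
    opaque
      reach? : ∀ w → Dec (Reach H u w)
      reach? w = map′ Within⇒Reach complete (within? (proj₁ closure) w)
        where
        complete : Reach H u w → Within (proj₁ closure) w
        complete r = let (m , p) = Reach⇒Within r in
          Closed-stable (proj₂ closure) m (subst (λ t → Within t w) (+-comm _ m) (Within-+ (proj₁ closure) p))

-- Components and the sequence seq(H)

module SortByKey {A : Set} (key : A → ℕ) where

  insert : A → List A → List A
  insert x [] = [ x ]
  insert x (y ∷ ys) with key y <? key x
  ... | yes _ = x ∷ y ∷ ys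
  ... | no _ = y ∷ insert x ys

  sort : List A → List A
  sort [] = []
  sort (x ∷ xs) = insert x (sort xs)

  insert-↭ : ∀ x ys → insert x ys ↭ x ∷ ys
  insert-↭ x [] = ↭-refl
  insert-↭ x (y ∷ ys) with key y <? key x
  ... | yes _ = ↭-refl
  ... | no _ = ↭-trans (↭-prep y (insert-↭ x ys)) (↭-swap y x ↭-refl)

  sort-↭ : ∀ xs → sort xs ↭ xs
  sort-↭ [] = ↭-refl
  sort-↭ (x ∷ xs) = ↭-trans (insert-↭ x (sort xs)) (↭-prep x (sort-↭ xs))

  insert-sorted : ∀ x ys → Linked (_≥_ on key) ys → Linked (_≥_ on key) (insert x ys)
  insert-sorted x [] _ = [-]
  insert-sorted x (y ∷ ys) sorted with key y <? key x
  ... | yes y<x = <⇒≤ y<x ∷ sorted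
  ... | no y≮x = go ys sorted (≮⇒≥ y≮x)
    where
    go : ∀ ys → Linked (_≥_ on key) (y ∷ ys) → key x ≤ key y → Linked (_≥_ on key) (y ∷ insert x ys)
    go [] _ x≤y = x≤y ∷ [-]
    go (z ∷ zs) (y≥z ∷ sorted) x≤y with key z <? key x | insert-sorted x (z ∷ zs) sorted
    ... | yes z<x | _ = x≤y ∷ <⇒≤ z<x ∷ sorted
    ... | no _ | sorted′ = y≥z ∷ sorted′

  sort-sorted : ∀ xs → Linked (_≥_ on key) (sort xs)
  sort-sorted [] = []
  sort-sorted (x ∷ xs) = insert-sorted x (sort xs) (sort-sorted xs)

AllPairs-deduplicate⁺ : ∀ {A : Set} {R S : A → A → Set} (R? : ∀ x y → Dec (R x y)) {xs} →
                        AllPairs S xs → AllPairs S (deduplicate R? xs)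
AllPairs-deduplicate⁺ R? [] = []
AllPairs-deduplicate⁺ R? (px ∷ pxs) =
  Allₚ.filter⁺ _ (Allₚ.deduplicate⁺ R? px) ∷ AllPairsₚ.filter⁺ _ (AllPairs-deduplicate⁺ R? pxs)

module Components {n} {G : CompleteMultipartite n} (H : SpanningSubgraph G) where
  open Reachability H public

  order : Fin n → ℕ
  order u = count (λ w → does (reach? u w))

  order-pos : ∀ u → 1 ≤ order u
  order-pos u = ≤-trans (≤-reflexive (cong ⟦_⟧ (sym (dec-true (reach? u u) here)))) (≤-sum _ u)

  Reach-setoid : DecSetoid _ _
  Reach-setoid = record
    { Carrier = Fin n
    ; _≈_ = Reach H
    ; isDecEquivalence = record
      { isEquivalence = record { refl = here ; sym = Reach-sym ; trans = Reach-trans }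
      ; _≟_ = reach?
      }
    }

  -- Deduplicating the vertices sorted by component order keeps one representative per component,
  -- still sorted.
  vertices : List (Fin n)
  vertices = SortByKey.sort order (allFin n)

  representatives : List (Fin n)
  representatives = deduplicate reach? vertices

  representatives-unique : AllPairs (λ r r′ → ¬ Reach H r r′) representatives
  representatives-unique = deduplicate-! Reach-setoid vertices

  representatives-sorted : Linked (_≥_ on order) representatives
  representatives-sorted = AllPairs⇒Linked (AllPairs-deduplicate⁺ reach?
    (Linked⇒AllPairs (λ y≤x z≤y → ≤-trans z≤y y≤x) (SortByKey.sort-sorted order (allFin n))))

  representatives-cover : ∀ u → Any (Reach H u) representatives
  representatives-cover u = ∈-deduplicate⁺ (DecSetoid.setoid Reach-setoid) reach?
    (λ zRy xRy → Reach-trans xRy (Reach-sym zRy))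
    (Any.map (λ { refl → here }) (Any-resp-↭ (↭-sym (SortByKey.sort-↭ order (allFin n))) (∈-allFin u)))

length-filterᵇ-tabulate : ∀ {A : Set} {n} (p : A → Bool) (f : Fin n → A) →
                          length (filterᵇ p (tabulate f)) ≡ count (p ∘ f)
length-filterᵇ-tabulate {n = zero} p f = refl
length-filterᵇ-tabulate {n = suc n} p f with p (f fz)
... | true = cong suc (length-filterᵇ-tabulate p (f ∘ fs))
... | false = length-filterᵇ-tabulate p (f ∘ fs)

classSize-count : ∀ {n s} (c : Fin n → Fin s) i → classSize c i ≡ count (λ u → c u ≡ᵇ i)
classSize-count c i = trans (length-filterᵇ-tabulate (λ u → ⌊ c u ≟ i ⌋) id)
                            (sum-cong-≗ λ u → cong ⟦_⟧ (isYes≗does (c u ≟ i)))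

AllPairs-lookup : ∀ {A : Set} {R : A → A → Set} {xs} → AllPairs R xs → ∀ i j → i ≢ j →
                  R (lookup xs i) (lookup xs j) ⊎ R (lookup xs j) (lookup xs i)
AllPairs-lookup (Rx ∷ _) fz fz i≢j = contradiction refl i≢j
AllPairs-lookup (Rx ∷ _) fz (fs j) _ = inj₁ (All.lookup Rx (∈-lookup j))
AllPairs-lookup (Rx ∷ _) (fs i) fz _ = inj₂ (All.lookup Rx (∈-lookup i))
AllPairs-lookup (_ ∷ Rxs) (fs i) (fs j) i≢j = AllPairs-lookup Rxs i j (i≢j ∘ cong fs)

module Labelling {n} {G : CompleteMultipartite n} (H : SpanningSubgraph G)
                 {s} (c : Fin n → Fin s) (c≡⇔Reach : ∀ u v → (c u ≡ c v) ⇔ Reach H u v) where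
  open Components H

  classSize-order : ∀ u → classSize c (c u) ≡ order u
  classSize-order u = trans (classSize-count c (c u)) (count-cong λ w →
    mk⇔ (λ e → dec-true (reach? u w) (Reach-sym (Equivalence.to (c≡⇔Reach w u) (≡ᵇ⇒≡ e))))
        (λ e → trans (cong (_≡ᵇ c u) (Equivalence.from (c≡⇔Reach w u) (Reach-sym (dec-true⁻ (reach? u w) e)))) (≡ᵇ-refl (c u))))

module ComponentSequence {n} {G : CompleteMultipartite n} (H : SpanningSubgraph G) where
  open Components H public

  label : Fin n → Fin (length representatives)
  label u = index (representatives-cover u)

  label-reach : ∀ u → Reach H u (lookup representatives (label u))
  label-reach u = lookup-index (representatives-cover u)

  representative-injective : ∀ i j → Reach H (lookup representatives i) (lookup representatives j) → i ≡ j
  representative-injective i j r with i ≟ j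
  ... | yes i≡j = i≡j
  ... | no i≢j with AllPairs-lookup representatives-unique i j i≢j
  ...   | inj₁ ¬r = contradiction r ¬r
  ...   | inj₂ ¬r = contradiction (Reach-sym r) ¬r

  label-lookup : ∀ i → label (lookup representatives i) ≡ i
  label-lookup i = representative-injective _ i (Reach-sym (label-reach (lookup representatives i)))

  label≡⇔Reach : ∀ u v → (label u ≡ label v) ⇔ Reach H u v
  label≡⇔Reach u v = mk⇔
    (λ e → Reach-trans (label-reach u) (subst (λ i → Reach H (lookup representatives i) v) (sym e) (Reach-sym (label-reach v))))
    (λ r → representative-injective _ _ (Reach-trans (Reach-sym (label-reach u)) (Reach-trans r (label-reach v))))

  componentSeq : List ℕ
  componentSeq = map order representatives

  componentSeq-IsSeq : IsSeq H componentSeq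
  componentSeq-IsSeq = length representatives , label , (λ i → lookup representatives i , label-lookup i) ,
                       label≡⇔Reach , tabulates , Linked.map⁺ representatives-sorted
    where
    open Labelling H label label≡⇔Reach
    tabulates : componentSeq ≡ map (classSize label) (allFin (length representatives))
    tabulates = begin
      map order representatives
        ≡⟨ cong (map order) (tabulate-lookup representatives) ⟨
      map order (tabulate (lookup representatives))
        ≡⟨ map-tabulate (lookup representatives) order ⟩
      tabulate (order ∘ lookup representatives)
        ≡⟨ tabulate-cong (λ i → trans (sym (classSize-order _)) (cong (classSize label) (label-lookup i))) ⟩
      tabulate (classSize label)
        ≡⟨ map-tabulate id (classSize label) ⟨
      map (classSize label) (allFin _) ∎
      where open ≡-Reasoning

-- Tail masses of sorted sequences

-- tailMass w xs sums the entries of xs that are at least w; for seq(H) it counts the vertices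
-- lying in components of order at least w, which makes sequences comparable through vertex counts.
tailMass : ℕ → List ℕ → ℕ
tailMass w [] = 0
tailMass w (x ∷ xs) = ⟦ w ≤ᵇ x ⟧ * x + tailMass w xs

≤ᵇ-true : ∀ {m n} → m ≤ n → (m ≤ᵇ n) ≡ true
≤ᵇ-true {m} {n} = dec-true (m ≤? n)

≤ᵇ-false : ∀ {m n} → n < m → (m ≤ᵇ n) ≡ false
≤ᵇ-false {m} {n} n<m = dec-false (m ≤? n) (<⇒≱ n<m)

Sorted : List ℕ → Set
Sorted = Linked _≥_

Sorted-tail : ∀ {x xs} → Sorted (x ∷ xs) → Sorted xs
Sorted-tail [-] = []
Sorted-tail (_ ∷ s) = s

Sorted-head : ∀ {x xs} → Sorted (x ∷ xs) → All (_≤ x) xs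
Sorted-head sorted with Linked⇒AllPairs (λ y≤x z≤y → ≤-trans z≤y y≤x) sorted
... | x≥xs ∷ _ = x≥xs

tailMass-small : ∀ {w xs} → All (_< w) xs → tailMass w xs ≡ 0
tailMass-small [] = refl
tailMass-small (x<w ∷ xs<w) rewrite ≤ᵇ-false x<w = tailMass-small xs<w

head≤tailMass : ∀ x xs → x ≤ tailMass x (x ∷ xs)
head≤tailMass x xs rewrite ≤ᵇ-true (≤-refl {x}) | +-identityʳ x = m≤m+n x _

tailMass-below : ∀ {w x} xs → x < w → Sorted (x ∷ xs) → tailMass w (x ∷ xs) ≡ 0
tailMass-below xs x<w sorted = tailMass-small (x<w ∷ All.map (λ y≤x → ≤-<-trans y≤x x<w) (Sorted-head sorted))

tailMass-∷-cancel : ∀ {w} x xs ys → tailMass w (x ∷ xs) ≡ tailMass w (x ∷ ys) → tailMass w xs ≡ tailMass w ys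
tailMass-∷-cancel {w} x xs ys = +-cancelˡ-≡ (⟦ w ≤ᵇ x ⟧ * x) _ _

head-mass≢0 : ∀ {y} ys → 1 ≤ y → tailMass y (y ∷ ys) ≢ 0
head-mass≢0 {y} ys 1≤y eq = contradiction (subst (1 ≤_) eq (≤-trans 1≤y (head≤tailMass y ys))) λ ()

tailMass-injective : ∀ {xs ys} → Sorted xs → Sorted ys → All (1 ≤_) xs → All (1 ≤_) ys →
                     (∀ w → tailMass w xs ≡ tailMass w ys) → xs ≡ ys
tailMass-injective {[]} {[]} _ _ _ _ _ = refl
tailMass-injective {[]} {y ∷ ys} _ _ _ (1≤y ∷ _) eq = ⊥-elim (head-mass≢0 ys 1≤y (sym (eq y)))
tailMass-injective {x ∷ xs} {[]} _ _ (1≤x ∷ _) _ eq = ⊥-elim (head-mass≢0 xs 1≤x (eq x))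
tailMass-injective {x ∷ xs} {y ∷ ys} sx sy (1≤x ∷ px) (1≤y ∷ py) eq with <-cmp x y
... | tri< x<y _ _ = ⊥-elim (head-mass≢0 ys 1≤y (trans (sym (eq y)) (tailMass-below xs x<y sx)))
... | tri> _ _ y<x = ⊥-elim (head-mass≢0 xs 1≤x (trans (eq x) (tailMass-below ys y<x sy)))
... | tri≈ _ refl _ = cong (x ∷_) (tailMass-injective (Sorted-tail sx) (Sorted-tail sy) px py (λ w → tailMass-∷-cancel x xs ys (eq w)))

⪰⇒tailMass-≥ : ∀ {xs ys} → xs ⪰ ys → Sorted xs → Sorted ys → ∀ T →
               (∀ w → T < w → tailMass w xs ≡ tailMass w ys) → tailMass T ys ≤ tailMass T xs
⪰⇒tailMass-≥ ⪰-eq _ _ T _ = ≤-refl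
⪰⇒tailMass-≥ (⪰-gt {a} {b} {xs} {ys} b<a) sx sy T agree with T <? a
... | yes T<a = contradiction (trans (agree a T<a) (tailMass-below ys b<a sy)) (head-mass≢0 xs (≤-trans (s≤s z≤n) b<a))
... | no T≮a = ≤-trans (≤-reflexive (tailMass-below ys (<-≤-trans b<a (≮⇒≥ T≮a)) sy)) z≤n
⪰⇒tailMass-≥ (⪰-cons {a} {xs} {ys} xs⪰ys) sx sy T agree =
  +-monoʳ-≤ (⟦ T ≤ᵇ a ⟧ * a) (⪰⇒tailMass-≥ xs⪰ys (Sorted-tail sx) (Sorted-tail sy) T (λ w → tailMass-∷-cancel {w} a xs ys ∘ agree w))

tailMass-tabulate : ∀ {s} w (g : Fin s → ℕ) → tailMass w (tabulate g) ≡ ∑[ i < s ] (⟦ w ≤ᵇ g i ⟧ * g i)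
tailMass-tabulate {zero} w g = refl
tailMass-tabulate {suc s} w g = cong (⟦ w ≤ᵇ g fz ⟧ * g fz +_) (tailMass-tabulate w (g ∘ fs))

Sorted-tabulate-head : ∀ {s} (g : Fin (suc s) → ℕ) → Sorted (tabulate g) → ∀ j → g j ≤ g fz
Sorted-tabulate-head g sorted fz = ≤-refl
Sorted-tabulate-head {suc s} g (g₁≤g₀ ∷ sorted) (fs j) = ≤-trans (Sorted-tabulate-head (g ∘ fs) sorted j) g₁≤g₀

module SeqFacts {n} {G : CompleteMultipartite n} (H : SpanningSubgraph G) {xs} (isq : IsSeq H xs) where
  open Components H public

  s : ℕ
  s = proj₁ isq

  c : Fin n → Fin s
  c = proj₁ (proj₂ isq)

  c-surjective : ∀ i → ∃[ u ] c u ≡ i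
  c-surjective = proj₁ (proj₂ (proj₂ isq))

  c≡⇔Reach : ∀ u v → (c u ≡ c v) ⇔ Reach H u v
  c≡⇔Reach = proj₁ (proj₂ (proj₂ (proj₂ isq)))

  xs-sorted : Sorted xs
  xs-sorted = proj₂ (proj₂ (proj₂ (proj₂ (proj₂ isq))))

  xs-tabulate : xs ≡ tabulate (classSize c)
  xs-tabulate = trans (proj₁ (proj₂ (proj₂ (proj₂ (proj₂ isq))))) (map-tabulate id (classSize c))

  open Labelling H c c≡⇔Reach public

  c-sameComponent : ∀ {u v} → c u ≡ c v → Reach H u v
  c-sameComponent {u} {v} = Equivalence.to (c≡⇔Reach u v)

  sameComponent-c : ∀ {u v} → Reach H u v → c u ≡ c v
  sameComponent-c {u} {v} = Equivalence.from (c≡⇔Reach u v)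

  classSize-pos : ∀ i → 1 ≤ classSize c i
  classSize-pos i with c-surjective i
  ... | u , refl = subst (1 ≤_) (sym (classSize-order u)) (order-pos u)

  xs-positive : All (1 ≤_) xs
  xs-positive = subst (All (1 ≤_)) (sym xs-tabulate) (Allₚ.tabulate⁺ classSize-pos)

  tailMass-count : ∀ w → tailMass w xs ≡ count (λ u → w ≤ᵇ order u)
  tailMass-count w = begin
    tailMass w xs
      ≡⟨ cong (tailMass w) xs-tabulate ⟩
    tailMass w (tabulate g)
      ≡⟨ tailMass-tabulate w g ⟩
    ∑[ i < s ] (⟦ w ≤ᵇ g i ⟧ * g i)
      ≡⟨ sum-cong-≗ (λ i → cong (⟦ w ≤ᵇ g i ⟧ *_) (classSize-count c i)) ⟩
    ∑[ i < s ] (⟦ w ≤ᵇ g i ⟧ * ∑[ u < n ] ⟦ c u ≡ᵇ i ⟧)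
      ≡⟨ sum-cong-≗ (λ i → *-distribˡ-sum ⟦ w ≤ᵇ g i ⟧ (λ u → ⟦ c u ≡ᵇ i ⟧)) ⟩
    ∑[ i < s ] ∑[ u < n ] (⟦ w ≤ᵇ g i ⟧ * ⟦ c u ≡ᵇ i ⟧)
      ≡⟨ ∑-comm (λ i u → ⟦ w ≤ᵇ g i ⟧ * ⟦ c u ≡ᵇ i ⟧) ⟩
    ∑[ u < n ] ∑[ i < s ] (⟦ w ≤ᵇ g i ⟧ * ⟦ c u ≡ᵇ i ⟧)
      ≡⟨ sum-cong-≗ (λ u → trans (sum-cong-≗ λ i → *-comm ⟦ w ≤ᵇ g i ⟧ _) (∑-point (c u) (λ i → ⟦ w ≤ᵇ g i ⟧))) ⟩
    ∑[ u < n ] ⟦ w ≤ᵇ g (c u) ⟧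
      ≡⟨ sum-cong-≗ (λ u → cong (λ t → ⟦ w ≤ᵇ t ⟧) (classSize-order u)) ⟩
    count (λ u → w ≤ᵇ order u) ∎
    where
    open ≡-Reasoning
    g = classSize c

  tailMass-zero : tailMass 0 xs ≡ n
  tailMass-zero = trans (tailMass-count 0) (count-true n)

  order≤or₁ : ∀ u → order u ≤ or₁ xs
  order≤or₁ u = subst₂ (λ t l → t ≤ or₁ l) (classSize-order u) (sym xs-tabulate)
    (≤-head (classSize c) (subst Sorted xs-tabulate xs-sorted) (c u))
    where
    ≤-head : ∀ {m} (g : Fin m → ℕ) → Sorted (tabulate g) → ∀ i → g i ≤ or₁ (tabulate g)
    ≤-head {suc m} g = Sorted-tabulate-head g

  -- The last edge of a walk between two vertices of the component joins two different parts.
  component-leaves-part : ∀ ℓ → 2 ≤ classSize c ℓ → ∀ j → ∃[ w ] c w ≡ ℓ × part G w ≢ j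
  component-leaves-part ℓ 2≤size j with count-two (λ w → c w ≡ᵇ ℓ) (subst (2 ≤_) (classSize-count c ℓ) 2≤size)
  ... | u , u′ , cu , cu′ , u≢u′ = leave (≡ᵇ⇒≡ cu′) u≢u′ (c-sameComponent (trans (≡ᵇ⇒≡ cu) (sym (≡ᵇ⇒≡ cu′))))
    where
    leave : ∀ {u′} → c u′ ≡ ℓ → u ≢ u′ → Reach H u u′ → ∃[ w ] c w ≡ ℓ × part G w ≢ j
    leave _ u≢u′ here = contradiction refl u≢u′
    leave {u′} cu′≡ℓ _ (step {w} r e) with part G u′ ≟ j
    ... | no pu′≢j = u′ , cu′≡ℓ , pu′≢j
    ... | yes refl = w , trans (sameComponent-c (Reach-sym r)) (≡ᵇ⇒≡ cu) , adj-sub H w u′ e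

  singleton-class : ∀ ℓ → classSize c ℓ ≤ 1 → ∀ {w w′} → c w ≡ ℓ → c w′ ≡ ℓ → w ≡ w′
  singleton-class ℓ size≤1 {w} {w′} cw cw′ with w ≟ w′
  ... | yes w≡w′ = w≡w′
  ... | no w≢w′ = contradiction (subst (2 ≤_) (sym (classSize-count c ℓ))
                    (2≤count (λ u → c u ≡ᵇ ℓ) (trans (cong (_≡ᵇ ℓ) cw) (≡ᵇ-refl ℓ)) (trans (cong (_≡ᵇ ℓ) cw′) (≡ᵇ-refl ℓ)) w≢w′))
                    (<⇒≱ (s≤s size≤1))

IsSeq-unique : ∀ {n} {G : CompleteMultipartite n} {H : SpanningSubgraph G} {xs ys} → IsSeq H xs → IsSeq H ys → xs ≡ ys
IsSeq-unique {H = H} isx isy = tailMass-injective X.xs-sorted Y.xs-sorted X.xs-positive Y.xs-positive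
  (λ w → trans (X.tailMass-count w) (sym (Y.tailMass-count w)))
  where
  module X = SeqFacts H isx
  module Y = SeqFacts H isy

Dip : ℕ → List ℕ → Set
Dip b xs = ∃[ pre ] ∃[ z ] ∃[ z′ ] ∃[ post ] xs ≡ pre ++ z ∷ z′ ∷ post × z′ ≤ z × 2 ≤ z × z < b

Sorted-++⁻ʳ : ∀ xs {ys} → Sorted (xs ++ ys) → Sorted ys
Sorted-++⁻ʳ [] sorted = sorted
Sorted-++⁻ʳ (x ∷ xs) sorted = Sorted-++⁻ʳ xs (Sorted-tail sorted)

plateau : ∀ b ys → All (_≤ b) ys →
          ∃[ t ] ∃[ rest ] ys ≡ replicate t b ++ rest × (rest ≡ [] ⊎ ∃[ z ] ∃[ rest′ ] rest ≡ z ∷ rest′ × z < b)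
plateau b [] [] = 0 , [] , refl , inj₁ refl
plateau b (y ∷ ys) (y≤b ∷ ys≤b) with m≤n⇒m<n∨m≡n y≤b
... | inj₁ y<b = 0 , y ∷ ys , refl , inj₂ (y , ys , refl , y<b)
... | inj₂ refl = let (t , rest , eq , end) = plateau b ys ys≤b in suc t , rest , cong (y ∷_) eq , end

replicate-snoc : ∀ t (x : ℕ) → x ∷ replicate t x ≡ replicate t x ++ [ x ]
replicate-snoc zero x = refl
replicate-snoc (suc t) x = cong (x ∷_) (replicate-snoc t x)

Sorted-ones : ∀ ys → Sorted (1 ∷ ys) → All (1 ≤_) ys → ys ≡ replicate (length ys) 1
Sorted-ones [] _ _ = refl
Sorted-ones (y ∷ ys) (y≤1 ∷ sorted) (1≤y ∷ pos) with ≤-antisym y≤1 1≤y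
... | refl = cong (1 ∷_) (Sorted-ones ys sorted pos)

Sorted-≥ : ∀ {a b xs} → Sorted (a ∷ b ∷ xs) → b ≤ a
Sorted-≥ (b≤a ∷ _) = b≤a

ones⊎≥2 : ∀ z ys → Sorted (z ∷ ys) → All (1 ≤_) (z ∷ ys) → (z ≡ 1 × ys ≡ replicate (length ys) 1) ⊎ 2 ≤ z
ones⊎≥2 (suc zero) ys sorted (_ ∷ pos) = inj₁ (refl , Sorted-ones ys sorted pos)
ones⊎≥2 (suc (suc z)) ys _ _ = inj₂ (s≤s (s≤s z≤n))

shape : ∀ a b r → Sorted (a ∷ b ∷ b ∷ r) → All (1 ≤_) r →
        ShapeA (a ∷ b ∷ b ∷ r) ⊎ ShapeB (a ∷ b ∷ b ∷ r) ⊎ Dip b (a ∷ b ∷ b ∷ r)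
shape a b r sorted pos with plateau b r (Sorted-head (Sorted-tail (Sorted-tail sorted)))
... | t , [] , refl , _ =
  inj₁ (a , b , b , suc t , cong (λ l → a ∷ b ∷ l) (trans (cong (b ∷_) (++-identityʳ _)) (replicate-snoc t b)) ,
        s≤s z≤n , Sorted-≥ sorted , ≤-refl , λ _ → refl)
... | t , z ∷ [] , refl , inj₂ (_ , _ , refl , z<b) =
  inj₁ (a , b , z , suc (suc t) , refl , s≤s z≤n , Sorted-≥ sorted , <⇒≤ z<b , λ ())
... | t , z ∷ z′ ∷ post , refl , inj₂ (_ , _ , refl , z<b)
    with ones⊎≥2 z (z′ ∷ post) (Sorted-++⁻ʳ (a ∷ b ∷ b ∷ replicate t b) sorted) (Allₚ.++⁻ʳ (replicate t b) pos)
...   | inj₁ (refl , ones) = inj₂ (inj₁ (a , b , suc (suc t) , suc (suc (length post)) ,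
          cong (λ l → a ∷ b ∷ b ∷ replicate t b ++ 1 ∷ l) ones , s≤s (s≤s z≤n) , s≤s (s≤s z≤n) , Sorted-≥ sorted , z<b))
...   | inj₂ 2≤z = inj₂ (inj₂ (a ∷ b ∷ b ∷ replicate t b , z , z′ , post , refl ,
          Sorted-≥ (Sorted-++⁻ʳ (a ∷ b ∷ b ∷ replicate t b) sorted) , 2≤z , z<b))

tabulate-adjacent : ∀ {s} (g : Fin s → ℕ) pre z z′ post → tabulate g ≡ pre ++ z ∷ z′ ∷ post →
                    ∃[ X ] ∃[ Y ] X ≢ Y × g X ≡ z × g Y ≡ z′
tabulate-adjacent {suc (suc s)} g [] z z′ post eq with ∷-injective eq
... | gX≡z , eq′ = fz , fs fz , (λ ()) , gX≡z , proj₁ (∷-injective eq′)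
tabulate-adjacent {suc s} g (_ ∷ pre) z z′ post eq
  with tabulate-adjacent (g ∘ fs) pre z z′ post (proj₂ (∷-injective eq))
... | X , Y , X≢Y , gX , gY = fs X , fs Y , X≢Y ∘ suc-injective , gX , gY

avoid-two : ∀ {s} {L₀ L₁ L₂ : Fin s} (X Y : Fin s) → L₀ ≢ L₁ → L₀ ≢ L₂ → L₁ ≢ L₂ → ∃[ L ] L ≢ X × L ≢ Y
avoid-two {L₀ = L₀} {L₁} {L₂} X Y L₀≢L₁ L₀≢L₂ L₁≢L₂ with L₀ ≟ X | L₀ ≟ Y | L₁ ≟ X | L₁ ≟ Y
... | no L₀≢X | no L₀≢Y | _ | _ = L₀ , L₀≢X , L₀≢Y
... | _ | _ | no L₁≢X | no L₁≢Y = L₁ , L₁≢X , L₁≢Y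
... | yes refl | _ | _ | yes refl = L₂ , L₀≢L₂ ∘ sym , L₁≢L₂ ∘ sym
... | _ | yes refl | yes refl | _ = L₂ , L₁≢L₂ ∘ sym , L₀≢L₂ ∘ sym
... | no _ | yes refl | no _ | yes refl = contradiction refl L₀≢L₁
... | yes refl | no _ | yes refl | no _ = contradiction refl L₀≢L₁

record TopThree {s} (g : Fin s → ℕ) (a b c : ℕ) : Set where
  field
    L₀ L₁ L₂ : Fin s
    L₀≢L₁ : L₀ ≢ L₁
    L₀≢L₂ : L₀ ≢ L₂
    L₁≢L₂ : L₁ ≢ L₂
    g-L₀ : g L₀ ≡ a
    g-L₁ : g L₁ ≡ b
    g-L₂ : g L₂ ≡ c
    ≤a : ∀ ℓ → g ℓ ≤ a
    ≤b : ∀ ℓ → ℓ ≢ L₀ → g ℓ ≤ b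
    ≤c : ∀ ℓ → ℓ ≢ L₀ → ℓ ≢ L₁ → g ℓ ≤ c

  third : ∀ X Y → ∃[ L ] L ≢ X × L ≢ Y
  third X Y = avoid-two X Y L₀≢L₁ L₀≢L₂ L₁≢L₂

topThree : ∀ {s} (g : Fin s → ℕ) → Sorted (tabulate g) → ∀ a b c r → tabulate g ≡ a ∷ b ∷ c ∷ r → TopThree g a b c
topThree {suc (suc (suc s))} g sorted a b c r eq = record
  { L₀ = fz ; L₁ = fs fz ; L₂ = fs (fs fz)
  ; L₀≢L₁ = λ () ; L₀≢L₂ = λ () ; L₁≢L₂ = λ ()
  ; g-L₀ = g₀ ; g-L₁ = g₁ ; g-L₂ = g₂
  ; ≤a = λ ℓ → subst (g ℓ ≤_) g₀ (Sorted-tabulate-head g sorted ℓ)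
  ; ≤b = ≤b
  ; ≤c = ≤c
  }
  where
  g₀ = proj₁ (∷-injective eq)
  g₁ = proj₁ (∷-injective (proj₂ (∷-injective eq)))
  g₂ = proj₁ (∷-injective (proj₂ (∷-injective (proj₂ (∷-injective eq)))))
  ≤b : ∀ ℓ → ℓ ≢ fz → g ℓ ≤ b
  ≤b fz ℓ≢0 = contradiction refl ℓ≢0
  ≤b (fs ℓ) _ = subst (g (fs ℓ) ≤_) g₁ (Sorted-tabulate-head (g ∘ fs) (Sorted-tail sorted) ℓ)
  ≤c : ∀ ℓ → ℓ ≢ fz → ℓ ≢ fs fz → g ℓ ≤ c
  ≤c fz ℓ≢0 _ = contradiction refl ℓ≢0
  ≤c (fs fz) _ ℓ≢1 = contradiction refl ℓ≢1
  ≤c (fs (fs ℓ)) _ _ = subst (g (fs (fs ℓ)) ≤_) g₂ (Sorted-tabulate-head (g ∘ fs ∘ fs) (Sorted-tail (Sorted-tail sorted)) ℓ)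

-- Counting edges

length-filterᵇ-++ : ∀ {A : Set} (p : A → Bool) xs ys →
                    length (filterᵇ p (xs ++ ys)) ≡ length (filterᵇ p xs) + length (filterᵇ p ys)
length-filterᵇ-++ p [] ys = refl
length-filterᵇ-++ p (x ∷ xs) ys with p x
... | true = cong suc (length-filterᵇ-++ p xs ys)
... | false = length-filterᵇ-++ p xs ys

length-filterᵇ-cartesianProduct : ∀ {n m} (p : Fin n × Fin m → Bool) →
  length (filterᵇ p (cartesianProduct (allFin n) (allFin m))) ≡ ∑[ u < n ] ∑[ w < m ] ⟦ p (u , w) ⟧
length-filterᵇ-cartesianProduct {n} {m} p = go id
  where
  go : ∀ {j} (f : Fin j → Fin n) →
       length (filterᵇ p (cartesianProductWith _,_ (tabulate f) (allFin m))) ≡ ∑[ u < j ] ∑[ w < m ] ⟦ p (f u , w) ⟧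
  go {zero} f = refl
  go {suc j} f = begin
    length (filterᵇ p (map (f fz ,_) (allFin m) ++ cartesianProductWith _,_ (tabulate (f ∘ fs)) (allFin m)))
      ≡⟨ length-filterᵇ-++ p (map (f fz ,_) (allFin m)) _ ⟩
    length (filterᵇ p (map (f fz ,_) (allFin m))) + length (filterᵇ p (cartesianProductWith _,_ (tabulate (f ∘ fs)) (allFin m)))
      ≡⟨ cong₂ _+_ (trans (cong (length ∘ filterᵇ p) (map-tabulate id (f fz ,_))) (length-filterᵇ-tabulate p (f fz ,_)))
                   (go (f ∘ fs)) ⟩
    ∑[ w < m ] ⟦ p (f fz , w) ⟧ + ∑[ u < j ] ∑[ w < m ] ⟦ p (f (fs u) , w) ⟧ ∎
    where open ≡-Reasoning

before : ∀ {n} → Fin n → Fin n → ℕ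
before u w = ⟦ toℕ u <ᵇ toℕ w ⟧

before-irrefl : ∀ {n} (v : Fin n) → before v v ≡ 0
before-irrefl v = cong ⟦_⟧ (dec-false (toℕ v <? toℕ v) (n≮n (toℕ v)))

before-total : ∀ {n} (v w : Fin n) → w ≢ v → before w v + before v w ≡ 1
before-total v w w≢v with <-cmp (toℕ w) (toℕ v)
... | tri< w<v _ v≮w = cong₂ _+_ (cong ⟦_⟧ (dec-true (toℕ w <? toℕ v) w<v)) (cong ⟦_⟧ (dec-false (toℕ v <? toℕ w) v≮w))
... | tri≈ _ w≡v _ = contradiction (toℕ-injective w≡v) w≢v
... | tri> w≮v _ v<w = cong₂ _+_ (cong ⟦_⟧ (dec-false (toℕ w <? toℕ v) w≮v)) (cong ⟦_⟧ (dec-true (toℕ v <? toℕ w) v<w))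

pairSum : ∀ {n} → (Fin n → Fin n → ℕ) → ℕ
pairSum {n} f = ∑[ u < n ] ∑[ w < n ] (before u w * f u w)

edges-pairSum : ∀ {n} {G : CompleteMultipartite n} (H : SpanningSubgraph G) → edges H ≡ pairSum (λ u w → ⟦ adj H u w ⟧)
edges-pairSum H =
  trans (length-filterᵇ-cartesianProduct (λ p → (toℕ (proj₁ p) <ᵇ toℕ (proj₂ p)) ∧ adj H (proj₁ p) (proj₂ p)))
                        (sum-cong-≗ λ u → sum-cong-≗ λ w → ⟦∧⟧ (toℕ u <ᵇ toℕ w) (adj H u w))

edges-mono : ∀ {n} {G : CompleteMultipartite n} (H₁ H₂ : SpanningSubgraph G) →
             (∀ u w → adj H₁ u w ≡ true → adj H₂ u w ≡ true) → edges H₁ ≤ edges H₂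
edges-mono H₁ H₂ H₁⊆H₂ = subst₂ _≤_ (sym (edges-pairSum H₁)) (sym (edges-pairSum H₂))
  (∑-mono-≤ λ u → ∑-mono-≤ λ w → *-monoʳ-≤ (before u w) (⟦⟧-mono (H₁⊆H₂ u w)))

pairsAvoiding : ∀ {n} → (Fin n → Fin n → ℕ) → Fin n → Fin n → ℕ
pairsAvoiding f v u = sum (except v (λ w → before u w * f u w))

module _ {n} (f : Fin n → Fin n → ℕ) (v : Fin n) (f-sym : ∀ u w → f u w ≡ f w u) (f-vv : f v v ≡ 0) where

  -- Split off the pairs containing v; by symmetry they contribute the full row of v.
  pairSum-split : pairSum f ≡ sum (f v) + sum (except v (pairsAvoiding f v))
  pairSum-split = begin
    pairSum f
      ≡⟨ sum-cong-≗ (λ u → sum-except (λ w → before u w * f u w) v) ⟩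
    ∑[ u < n ] (before u v * f u v + P u)
      ≡⟨ ∑-distrib-+ (λ u → before u v * f u v) P ⟩
    ∑[ u < n ] (before u v * f u v) + sum P
      ≡⟨ cong (column +_) (sum-except P v) ⟩
    ∑[ u < n ] (before u v * f u v) + (P v + sum (except v P))
      ≡⟨ +-assoc column (P v) _ ⟨
    ∑[ u < n ] (before u v * f u v) + P v + sum (except v P)
      ≡⟨ cong (_+ sum (except v P)) row ⟩
    sum (f v) + sum (except v P) ∎
    where
    P = pairsAvoiding f v
    column = ∑[ u < n ] (before u v * f u v)
    open ≡-Reasoning
    row-v : P v ≡ ∑[ w < n ] (before v w * f v w)
    row-v = sym (trans (sum-except _ v) (cong (_+ P v) (cong (_* f v v) (before-irrefl v))))
    column+row : ∀ w → before w v * f w v + before v w * f v w ≡ f v w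
    column+row w with w ≟ v
    ... | yes refl rewrite before-irrefl v | f-vv = refl
    ... | no w≢v = begin
      before w v * f w v + before v w * f v w  ≡⟨ cong (λ t → before w v * t + before v w * f v w) (f-sym w v) ⟩
      before w v * f v w + before v w * f v w  ≡⟨ *-distribʳ-+ (f v w) (before w v) (before v w) ⟨
      (before w v + before v w) * f v w        ≡⟨ cong (_* f v w) (before-total v w w≢v) ⟩
      1 * f v w                                ≡⟨ *-identityˡ (f v w) ⟩
      f v w ∎
    row : column + P v ≡ sum (f v)
    row = trans (cong (column +_) row-v)
                (trans (sym (∑-distrib-+ (λ u → before u v * f u v) (λ w → before v w * f v w))) (sum-cong-≗ column+row))

pairSum-≤ : ∀ {n} (f f′ : Fin n → Fin n → ℕ) (v : Fin n) →
            (∀ u w → f u w ≡ f w u) → (∀ u w → f′ u w ≡ f′ w u) → f v v ≡ 0 → f′ v v ≡ 0 →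
            (∀ u w → u ≢ v → w ≢ v → f u w ≡ f′ u w) → sum (f v) ≤ sum (f′ v) → pairSum f ≤ pairSum f′
pairSum-≤ f f′ v f-sym f′-sym f-vv f′-vv agree row≤ = begin
  pairSum f                                                ≡⟨ pairSum-split f v f-sym f-vv ⟩
  sum (f v) + sum (except v (pairsAvoiding f v))           ≤⟨ +-monoˡ-≤ _ row≤ ⟩
  sum (f′ v) + sum (except v (pairsAvoiding f v))          ≡⟨ cong (sum (f′ v) +_) (sum-cong-≗ same) ⟩
  sum (f′ v) + sum (except v (pairsAvoiding f′ v))         ≡⟨ pairSum-split f′ v f′-sym f′-vv ⟨
  pairSum f′ ∎
  where
  open ≤-Reasoning
  same : ∀ u → except v (pairsAvoiding f v) u ≡ except v (pairsAvoiding f′ v) u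
  same u with u ≟ v
  ... | yes _ = refl
  ... | no u≢v = sum-cong-≗ same-row
    where
    same-row : ∀ w → except v (λ w → before u w * f u w) w ≡ except v (λ w → before u w * f′ u w) w
    same-row w with w ≟ v
    ... | yes _ = refl
    ... | no w≢v = cong (before u w *_) (agree u w u≢v w≢v)

two-elements : ∀ {A : Set} (xs : List A) (i j : Fin (length xs)) → i ≢ j → ∃[ x ] ∃[ y ] ∃[ rest ] xs ≡ x ∷ y ∷ rest
two-elements (x ∷ y ∷ rest) _ _ _ = x , y , rest , refl
two-elements (x ∷ []) fz fz i≢j = contradiction refl i≢j

InS-intro : ∀ {n} {G : CompleteMultipartite n} (H : SpanningSubgraph G) q → let open Components H in
            (∀ u v → ¬ Reach H u v → order u + order v ≤ q) → ∀ u v → ¬ Reach H u v → InS q H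
InS-intro H q pair≤q u v ¬uv =
  from-two (two-elements representatives (label u) (label v) (¬uv ∘ Equivalence.to (label≡⇔Reach u v)))
  where
  open ComponentSequence H
  from-two : (∃[ r₀ ] ∃[ r₁ ] ∃[ rest ] representatives ≡ r₀ ∷ r₁ ∷ rest) → InS q H
  from-two (r₀ , r₁ , rest , eq) with subst (AllPairs (λ r r′ → ¬ Reach H r r′)) eq representatives-unique
  ... | (¬r₀r₁ ∷ _) ∷ _ = componentSeq , componentSeq-IsSeq , order r₀ , order r₁ , map order rest ,
                          cong (map order) eq , pair≤q r₀ r₁ ¬r₀r₁

module ClassGraph {n} (G : CompleteMultipartite n) where

  crossing : Fin n → Fin n → Bool
  crossing u w = not (part G u ≡ᵇ part G w)

  ⟪_⟫ : ∀ {s} → (Fin n → Fin s) → SpanningSubgraph G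
  ⟪ d ⟫ = record
    { adj = λ u w → (d u ≡ᵇ d w) ∧ crossing u w
    ; adj-sym = λ u w → cong₂ _∧_ (≡ᵇ-sym (d u) (d w)) (cong not (≡ᵇ-sym (part G u) (part G w)))
    ; adj-sub = λ u w e → crossing-true u w (proj₂ (∧-true (d u ≡ᵇ d w) e))
    }
    where
    crossing-true : ∀ u w → crossing u w ≡ true → part G u ≢ part G w
    crossing-true u w e eq rewrite eq | ≡ᵇ-refl (part G w) = case e of λ ()

  module _ {s} (d : Fin n → Fin s) where
    open Components ⟪ d ⟫

    ⟪⟫-adj : ∀ {u w} → d u ≡ d w → part G u ≢ part G w → adj ⟪ d ⟫ u w ≡ true
    ⟪⟫-adj {u} {w} du≡dw pu≢pw rewrite du≡dw | ≡ᵇ-refl (d w) | ≢⇒≡ᵇ-false pu≢pw = refl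

    ⊆⟪⟫ : ∀ {K : SpanningSubgraph G} → (∀ u w → adj K u w ≡ true → d u ≡ d w) → ∀ u w → adj K u w ≡ true → adj ⟪ d ⟫ u w ≡ true
    ⊆⟪⟫ {K} within-classes u w e = ⟪⟫-adj (within-classes u w e) (adj-sub K u w e)

    ⟪⟫-adj-no-loop : ∀ u → adj ⟪ d ⟫ u u ≡ false
    ⟪⟫-adj-no-loop u rewrite ≡ᵇ-refl (part G u) = ∧-zeroʳ (d u ≡ᵇ d u)

    ⟪⟫-Reach : ∀ {u w} → Reach ⟪ d ⟫ u w → d u ≡ d w
    ⟪⟫-Reach here = refl
    ⟪⟫-Reach (step {v} {w} r e) = trans (⟪⟫-Reach r) (≡ᵇ⇒≡ (proj₁ (∧-true (d v ≡ᵇ d w) e)))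

    -- Distinct components inside one class are disjoint subsets of it.
    order+order≤classSize : ∀ r r′ → ¬ Reach ⟪ d ⟫ r r′ → d r ≡ d r′ → order r + order r′ ≤ classSize d (d r)
    order+order≤classSize r r′ ¬rr′ dr≡dr′ = begin
      order r + order r′
        ≡⟨ ∑-distrib-+ (λ w → ⟦ does (reach? r w) ⟧) _ ⟨
      ∑[ w < n ] (⟦ does (reach? r w) ⟧ + ⟦ does (reach? r′ w) ⟧)
        ≤⟨ ∑-mono-≤ pointwise ⟩
      count (λ w → d w ≡ᵇ d r)
        ≡⟨ classSize-count d (d r) ⟨
      classSize d (d r) ∎
      where
      open ≤-Reasoning
      pointwise : ∀ w → ⟦ does (reach? r w) ⟧ + ⟦ does (reach? r′ w) ⟧ ≤ ⟦ d w ≡ᵇ d r ⟧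
      pointwise w with reach? r w | reach? r′ w
      ... | no _ | no _ = z≤n
      ... | yes rw | yes r′w = contradiction (Reach-trans rw (Reach-sym r′w)) ¬rr′
      ... | yes rw | no _ rewrite ⟪⟫-Reach rw | ≡ᵇ-refl (d w) = ≤-refl
      ... | no _ | yes r′w rewrite dr≡dr′ | ⟪⟫-Reach r′w | ≡ᵇ-refl (d w) = ≤-refl

    order≤classSize : ∀ r → order r ≤ classSize d (d r)
    order≤classSize r = begin
      order r                    ≤⟨ ∑-mono-≤ (λ w → ⟦does⟧-mono (sym ∘ ⟪⟫-Reach) (reach? r w) (d w ≟ d r)) ⟩
      count (λ w → d w ≡ᵇ d r)   ≡⟨ classSize-count d (d r) ⟨
      classSize d (d r) ∎
      where open ≤-Reasoning

    ⟪⟫-InS : ∀ q → (∀ ℓ → classSize d ℓ ≤ q) → (∀ ℓ ℓ′ → ℓ ≢ ℓ′ → classSize d ℓ + classSize d ℓ′ ≤ q) →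
             ∀ u v → d u ≢ d v → InS q ⟪ d ⟫
    ⟪⟫-InS q one≤q two≤q u v du≢dv = InS-intro ⟪ d ⟫ q pair≤q u v (du≢dv ∘ ⟪⟫-Reach)
      where
      pair≤q : ∀ r r′ → ¬ Reach ⟪ d ⟫ r r′ → order r + order r′ ≤ q
      pair≤q r r′ ¬rr′ with d r ≟ d r′
      ... | yes dr≡dr′ = ≤-trans (order+order≤classSize r r′ ¬rr′ dr≡dr′) (one≤q (d r))
      ... | no dr≢dr′ = ≤-trans (+-mono-≤ (order≤classSize r) (order≤classSize r′)) (two≤q _ _ dr≢dr′)

-- Averaging over the parts of G

averaging-arith : ∀ m x y → 1 ≤ m → y ≤ x → m * y + x < m * x + y + m
averaging-arith (suc m) x y _ y≤x = begin-strict
  suc m * y + x        ≡⟨ solve 3 (λ m x y → (y :+ m :* y) :+ x := (x :+ y) :+ m :* y) refl m x y ⟩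
  (x + y) + m * y      ≤⟨ +-monoʳ-≤ (x + y) (*-monoʳ-≤ m y≤x) ⟩
  (x + y) + m * x      ≡⟨ solve 3 (λ m x y → (x :+ y) :+ m :* x := (x :+ m :* x) :+ y) refl m x y ⟩
  suc m * x + y        <⟨ m<m+n _ (s≤s z≤n) ⟩
  suc m * x + y + suc m ∎
  where open ≤-Reasoning

module Parts {n} (G : CompleteMultipartite n) {s} (d : Fin n → Fin s) where
  open ClassGraph G

  inPart : Fin s → Fin (k G) → ℕ
  inPart L j = count (λ w → (d w ≡ᵇ L) ∧ (j ≡ᵇ part G w))

  crossDegree : Fin n → Fin s → ℕ
  crossDegree v L = count (λ w → (d w ≡ᵇ L) ∧ crossing v w)

  crossDegree+inPart : ∀ v L → crossDegree v L + inPart L (part G v) ≡ classSize d L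
  crossDegree+inPart v L = begin
    crossDegree v L + inPart L (part G v)
      ≡⟨ ∑-distrib-+ (λ w → ⟦ (d w ≡ᵇ L) ∧ crossing v w ⟧) _ ⟨
    ∑[ w < n ] (⟦ (d w ≡ᵇ L) ∧ crossing v w ⟧ + ⟦ (d w ≡ᵇ L) ∧ (part G v ≡ᵇ part G w) ⟧)
      ≡⟨ sum-cong-≗ (λ w → split (d w ≡ᵇ L) (part G v ≡ᵇ part G w)) ⟩
    count (λ w → d w ≡ᵇ L)
      ≡⟨ classSize-count d L ⟨
    classSize d L ∎
    where
    open ≡-Reasoning
    split : ∀ a b → ⟦ a ∧ not b ⟧ + ⟦ a ∧ b ⟧ ≡ ⟦ a ⟧
    split true true = refl
    split true false = refl
    split false b = refl

  ∑-inPart : ∀ L → ∑[ j < k G ] inPart L j ≡ classSize d L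
  ∑-inPart L = begin
    ∑[ j < k G ] ∑[ w < n ] ⟦ (d w ≡ᵇ L) ∧ (j ≡ᵇ part G w) ⟧
      ≡⟨ ∑-comm (λ j w → ⟦ (d w ≡ᵇ L) ∧ (j ≡ᵇ part G w) ⟧) ⟩
    ∑[ w < n ] ∑[ j < k G ] ⟦ (d w ≡ᵇ L) ∧ (j ≡ᵇ part G w) ⟧
      ≡⟨ sum-cong-≗ (λ w → trans (sum-cong-≗ (λ j → reorder w j)) (∑-point (part G w) (λ _ → ⟦ d w ≡ᵇ L ⟧))) ⟩
    count (λ w → d w ≡ᵇ L)
      ≡⟨ classSize-count d L ⟨
    classSize d L ∎
    where
    open ≡-Reasoning
    reorder : ∀ w j → ⟦ (d w ≡ᵇ L) ∧ (j ≡ᵇ part G w) ⟧ ≡ ⟦ part G w ≡ᵇ j ⟧ * ⟦ d w ≡ᵇ L ⟧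
    reorder w j = trans (⟦∧⟧ (d w ≡ᵇ L) _) (trans (*-comm ⟦ d w ≡ᵇ L ⟧ _) (cong (λ b → ⟦ b ⟧ * _) (≡ᵇ-sym j (part G w))))

  private
    positive : ℕ → ℕ
    positive zero = 0
    positive (suc _) = 1

  -- Summed over the m ≥ 1 parts meeting Y, these inequalities give m|X| + |Y| + m ≤ m|Y| + |X|.
  not-all-parts-crowded : ∀ X Y u → d u ≡ Y → classSize d Y ≤ classSize d X →
    ¬ (∀ j → 1 ≤ inPart Y j → classSize d X + inPart Y j < classSize d Y + inPart X j)
  not-all-parts-crowded X Y u du≡Y Y≤X crowded = <⇒≱ (averaging-arith m x y 1≤m Y≤X) total
    where
    x = classSize d X
    y = classSize d Y
    ind : Fin (k G) → ℕ
    ind j = positive (inPart Y j)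
    m = ∑[ j < k G ] ind j
    1≤m : 1 ≤ m
    1≤m = ≤-trans (meets (inPart Y (part G u)) (≤-sum _ u)) (≤-sum ind (part G u))
      where
      meets : ∀ t → ⟦ (d u ≡ᵇ Y) ∧ (part G u ≡ᵇ part G u) ⟧ ≤ t → 1 ≤ positive t
      meets (suc _) _ = ≤-refl
      meets zero u∈Y rewrite du≡Y | ≡ᵇ-refl Y | ≡ᵇ-refl (part G u) = contradiction u∈Y λ ()
    pointwise : ∀ j → ind j * x + inPart Y j + ind j ≤ ind j * y + ind j * inPart X j
    pointwise j with inPart Y j in eq
    ... | zero = z≤n
    ... | suc t = subst₂ _≤_ (cong₂ (λ a b → a + b + 1) (sym (*-identityˡ x)) eq) (cong₂ _+_ (sym (*-identityˡ y)) (sym (*-identityˡ _)))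
                    (subst (_≤ y + inPart X j) (+-comm 1 _) (crowded j (subst (1 ≤_) (sym eq) (s≤s z≤n))))
    ind*inPartX : ∀ j → ind j * inPart X j ≤ inPart X j
    ind*inPartX j with inPart Y j
    ... | zero = z≤n
    ... | suc _ = ≤-reflexive (+-identityʳ _)
    total : m * x + y + m ≤ m * y + x
    total = begin
      m * x + y + m
        ≡⟨ cong₂ (λ a b → a + b + m) (*-distribʳ-sum x ind) (sym (∑-inPart Y)) ⟩
      ∑[ j < k G ] (ind j * x) + ∑[ j < k G ] inPart Y j + m
        ≡⟨ cong (_+ m) (∑-distrib-+ (λ j → ind j * x) (inPart Y)) ⟨
      ∑[ j < k G ] (ind j * x + inPart Y j) + m
        ≡⟨ ∑-distrib-+ (λ j → ind j * x + inPart Y j) ind ⟨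
      ∑[ j < k G ] (ind j * x + inPart Y j + ind j)
        ≤⟨ ∑-mono-≤ pointwise ⟩
      ∑[ j < k G ] (ind j * y + ind j * inPart X j)
        ≡⟨ ∑-distrib-+ (λ j → ind j * y) _ ⟩
      ∑[ j < k G ] (ind j * y) + ∑[ j < k G ] (ind j * inPart X j)
        ≤⟨ +-mono-≤ (≤-reflexive (sym (*-distribʳ-sum y ind))) (∑-mono-≤ ind*inPartX) ⟩
      m * y + ∑[ j < k G ] inPart X j
        ≡⟨ cong (m * y +_) (∑-inPart X) ⟩
      m * y + x ∎
      where open ≤-Reasoning

  some-uncrowded-part : ∀ X Y u → d u ≡ Y → classSize d Y ≤ classSize d X →
                        ∃[ j ] 1 ≤ inPart Y j × classSize d Y + inPart X j ≤ classSize d X + inPart Y j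
  some-uncrowded-part X Y u du≡Y Y≤X
    with any? (λ j → (1 ≤? inPart Y j) ×-dec (classSize d Y + inPart X j ≤? classSize d X + inPart Y j))
  ... | yes found = found
  ... | no none = ⊥-elim (not-all-parts-crowded X Y u du≡Y Y≤X λ j 1≤ → ≰⇒> (λ le → none (j , 1≤ , le)))

  averaging : ∀ X Y u → d u ≡ Y → classSize d Y ≤ classSize d X → ∃[ v ] d v ≡ Y × crossDegree v Y ≤ crossDegree v X
  averaging X Y u du≡Y Y≤X with some-uncrowded-part X Y u du≡Y Y≤X
  ... | j , 1≤inY , big with count-witness (λ w → (d w ≡ᵇ Y) ∧ (j ≡ᵇ part G w)) 1≤inY
  ...   | v , v∈Y∩j with ∧-true (d v ≡ᵇ Y) v∈Y∩j
  ...     | dv≡Y , j≡pv = v , ≡ᵇ⇒≡ dv≡Y , degree≤ {v} {j} big (≡ᵇ⇒≡ j≡pv)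
    where
    degree≤ : ∀ {v j} → classSize d Y + inPart X j ≤ classSize d X + inPart Y j → j ≡ part G v →
              crossDegree v Y ≤ crossDegree v X
    degree≤ {v} {j} big refl = +-cancelʳ-≤ (inPart Y j + inPart X j) _ _ (begin
      crossDegree v Y + (inPart Y j + inPart X j)   ≡⟨ +-assoc (crossDegree v Y) _ _ ⟨
      crossDegree v Y + inPart Y j + inPart X j     ≡⟨ cong (_+ inPart X j) (crossDegree+inPart v Y) ⟩
      classSize d Y + inPart X j                    ≤⟨ big ⟩
      classSize d X + inPart Y j                    ≡⟨ cong (_+ inPart Y j) (crossDegree+inPart v X) ⟨
      crossDegree v X + inPart X j + inPart Y j     ≡⟨ +-assoc (crossDegree v X) _ _ ⟩
      crossDegree v X + (inPart X j + inPart Y j)   ≡⟨ cong (crossDegree v X +_) (+-comm (inPart X j) _) ⟩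
      crossDegree v X + (inPart Y j + inPart X j)   ∎)
      where open ≤-Reasoning

-- Moving one vertex to another class

module Move {n} {G : CompleteMultipartite n} (H : SpanningSubgraph G) {xs} (isq : IsSeq H xs)
            (X Y : Fin (SeqFacts.s H isq)) (X≢Y : X ≢ Y) (v : Fin n) (cv≡Y : SeqFacts.c H isq v ≡ Y) where
  open SeqFacts H isq
  open ClassGraph G
  open Parts G c using (crossDegree)

  c′ : Fin n → Fin s
  c′ u = if u ≡ᵇ v then X else c u

  H′ : SpanningSubgraph G
  H′ = ⟪ c′ ⟫

  module H′ = Components H′

  c′-v : c′ v ≡ X
  c′-v rewrite ≡ᵇ-refl v = refl

  c′-other : ∀ {u} → u ≢ v → c′ u ≡ c u
  c′-other u≢v rewrite ≢⇒≡ᵇ-false u≢v = refl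

  ≢Y⇒≢v : ∀ {u} → c u ≢ Y → u ≢ v
  ≢Y⇒≢v cu≢Y refl = cu≢Y cv≡Y

  classSize-move : ∀ ℓ → classSize c′ ℓ + ⟦ Y ≡ᵇ ℓ ⟧ ≡ classSize c ℓ + ⟦ X ≡ᵇ ℓ ⟧
  classSize-move ℓ = begin
    classSize c′ ℓ + ⟦ Y ≡ᵇ ℓ ⟧
      ≡⟨ cong (_+ ⟦ Y ≡ᵇ ℓ ⟧) (trans (classSize-count c′ ℓ) (sum-except _ v)) ⟩
    ⟦ c′ v ≡ᵇ ℓ ⟧ + sum (except v (λ w → ⟦ c′ w ≡ᵇ ℓ ⟧)) + ⟦ Y ≡ᵇ ℓ ⟧
      ≡⟨ cong₂ (λ a b → ⟦ a ≡ᵇ ℓ ⟧ + b + ⟦ Y ≡ᵇ ℓ ⟧) c′-v (sum-cong-≗ away-from-v) ⟩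
    ⟦ X ≡ᵇ ℓ ⟧ + sum (except v (λ w → ⟦ c w ≡ᵇ ℓ ⟧)) + ⟦ Y ≡ᵇ ℓ ⟧
      ≡⟨ xy∙z≈zy∙x ⟦ X ≡ᵇ ℓ ⟧ _ _ ⟩
    ⟦ Y ≡ᵇ ℓ ⟧ + sum (except v (λ w → ⟦ c w ≡ᵇ ℓ ⟧)) + ⟦ X ≡ᵇ ℓ ⟧
      ≡⟨ cong (λ a → ⟦ a ≡ᵇ ℓ ⟧ + _ + ⟦ X ≡ᵇ ℓ ⟧) cv≡Y ⟨
    ⟦ c v ≡ᵇ ℓ ⟧ + sum (except v (λ w → ⟦ c w ≡ᵇ ℓ ⟧)) + ⟦ X ≡ᵇ ℓ ⟧
      ≡⟨ cong (_+ ⟦ X ≡ᵇ ℓ ⟧) (trans (classSize-count c ℓ) (sum-except _ v)) ⟨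
    classSize c ℓ + ⟦ X ≡ᵇ ℓ ⟧ ∎
    where
    open ≡-Reasoning
    away-from-v : ∀ w → except v (λ w → ⟦ c′ w ≡ᵇ ℓ ⟧) w ≡ except v (λ w → ⟦ c w ≡ᵇ ℓ ⟧) w
    away-from-v w with w ≟ v
    ... | yes _ = refl
    ... | no _ = refl

  classSize-X : classSize c′ X ≡ suc (classSize c X)
  classSize-X = begin
    classSize c′ X                ≡⟨ +-identityʳ _ ⟨
    classSize c′ X + 0            ≡⟨ cong (λ b → classSize c′ X + ⟦ b ⟧) (≢⇒≡ᵇ-false (X≢Y ∘ sym)) ⟨
    classSize c′ X + ⟦ Y ≡ᵇ X ⟧    ≡⟨ classSize-move X ⟩
    classSize c X + ⟦ X ≡ᵇ X ⟧     ≡⟨ cong (λ b → classSize c X + ⟦ b ⟧) (≡ᵇ-refl X) ⟩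
    classSize c X + 1             ≡⟨ +-comm _ 1 ⟩
    suc (classSize c X) ∎
    where open ≡-Reasoning

  classSize-Y : suc (classSize c′ Y) ≡ classSize c Y
  classSize-Y = begin
    suc (classSize c′ Y)          ≡⟨ +-comm 1 _ ⟩
    classSize c′ Y + 1            ≡⟨ cong (λ b → classSize c′ Y + ⟦ b ⟧) (≡ᵇ-refl Y) ⟨
    classSize c′ Y + ⟦ Y ≡ᵇ Y ⟧    ≡⟨ classSize-move Y ⟩
    classSize c Y + ⟦ X ≡ᵇ Y ⟧     ≡⟨ cong (λ b → classSize c Y + ⟦ b ⟧) (≢⇒≡ᵇ-false X≢Y) ⟩
    classSize c Y + 0             ≡⟨ +-identityʳ _ ⟩
    classSize c Y ∎
    where open ≡-Reasoning

  classSize-≤ : ∀ ℓ → ℓ ≢ X → classSize c′ ℓ ≤ classSize c ℓ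
  classSize-≤ ℓ ℓ≢X = begin
    classSize c′ ℓ                 ≤⟨ m≤m+n _ _ ⟩
    classSize c′ ℓ + ⟦ Y ≡ᵇ ℓ ⟧     ≡⟨ classSize-move ℓ ⟩
    classSize c ℓ + ⟦ X ≡ᵇ ℓ ⟧      ≡⟨ cong (λ b → classSize c ℓ + ⟦ b ⟧) (≢⇒≡ᵇ-false (ℓ≢X ∘ sym)) ⟩
    classSize c ℓ + 0              ≡⟨ +-identityʳ _ ⟩
    classSize c ℓ ∎
    where open ≤-Reasoning

  classSize-other : ∀ ℓ → ℓ ≢ X → ℓ ≢ Y → classSize c′ ℓ ≡ classSize c ℓ
  classSize-other ℓ ℓ≢X ℓ≢Y = begin
    classSize c′ ℓ                ≡⟨ +-identityʳ _ ⟨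
    classSize c′ ℓ + 0            ≡⟨ cong (λ b → classSize c′ ℓ + ⟦ b ⟧) (≢⇒≡ᵇ-false (ℓ≢Y ∘ sym)) ⟨
    classSize c′ ℓ + ⟦ Y ≡ᵇ ℓ ⟧    ≡⟨ classSize-move ℓ ⟩
    classSize c ℓ + ⟦ X ≡ᵇ ℓ ⟧     ≡⟨ cong (λ b → classSize c ℓ + ⟦ b ⟧) (≢⇒≡ᵇ-false (ℓ≢X ∘ sym)) ⟩
    classSize c ℓ + 0             ≡⟨ +-identityʳ _ ⟩
    classSize c ℓ ∎
    where open ≡-Reasoning

  edges-≤ : crossDegree v Y ≤ crossDegree v X → edges H ≤ edges H′
  edges-≤ degree≤ = ≤-trans (edges-mono H ⟪ c ⟫ (⊆⟪⟫ c {H} (λ u w e → sameComponent-c (step here e))))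
    (subst₂ _≤_ (sym (edges-pairSum ⟪ c ⟫)) (sym (edges-pairSum H′))
      (pairSum-≤ (adjacency ⟪ c ⟫) (adjacency H′) v (symmetric ⟪ c ⟫) (symmetric H′) (no-loop c) (no-loop c′) agree
        (subst₂ _≤_ (sym row-before) (sym row-after) degree≤)))
    where
    adjacency : SpanningSubgraph G → Fin n → Fin n → ℕ
    adjacency K u w = ⟦ adj K u w ⟧
    symmetric : ∀ K u w → adjacency K u w ≡ adjacency K w u
    symmetric K u w = cong ⟦_⟧ (adj-sym K u w)
    no-loop : ∀ (d : Fin n → Fin s) → adjacency ⟪ d ⟫ v v ≡ 0
    no-loop d = cong ⟦_⟧ (⟪⟫-adj-no-loop d v)
    agree : ∀ u w → u ≢ v → w ≢ v → adjacency ⟪ c ⟫ u w ≡ adjacency H′ u w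
    agree u w u≢v w≢v = cong₂ (λ a b → ⟦ (a ≡ᵇ b) ∧ crossing u w ⟧) (sym (c′-other u≢v)) (sym (c′-other w≢v))
    row-before : sum (adjacency ⟪ c ⟫ v) ≡ crossDegree v Y
    row-before = sum-cong-≗ λ w → cong (λ b → ⟦ b ∧ crossing v w ⟧) (trans (cong (_≡ᵇ c w) cv≡Y) (≡ᵇ-sym Y (c w)))
    row-after : sum (adjacency H′ v) ≡ crossDegree v X
    row-after = sum-cong-≗ pointwise
      where
      pointwise : ∀ w → adjacency H′ v w ≡ ⟦ (c w ≡ᵇ X) ∧ crossing v w ⟧
      pointwise w with w ≟ v
      ... | yes w≡v = cong ⟦_⟧ (trans (cong (_ ∧_) no-cross)
                                (trans (∧-zeroʳ _) (sym (trans (cong (_ ∧_) no-cross) (∧-zeroʳ _)))))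
        where
        no-cross : crossing v w ≡ false
        no-cross rewrite w≡v | ≡ᵇ-refl (part G v) = refl
      ... | no _ = cong (λ b → ⟦ b ∧ crossing v w ⟧) (trans (cong (_≡ᵇ c w) c′-v) (≡ᵇ-sym X (c w)))

  -- A walk of H that starts outside class Y never meets v, so it survives the move.
  Reach-outside-Y : ∀ {u w} → c u ≢ Y → Reach H u w → Reach H′ u w
  Reach-outside-Y cu≢Y here = here
  Reach-outside-Y {u} cu≢Y (step {v₀} {w} r e) = step (Reach-outside-Y cu≢Y r)
    (⟪⟫-adj c′ (trans (c′-other (≢Y⇒≢v (cu≢Y ∘ trans cu≡cv₀)))
                      (trans (sym cu≡cv₀) (trans cu≡cw (sym (c′-other (≢Y⇒≢v (cu≢Y ∘ trans cu≡cw)))))))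
               (adj-sub H v₀ w e))
    where
    cu≡cv₀ : c u ≡ c v₀
    cu≡cv₀ = sameComponent-c r
    cu≡cw : c u ≡ c w
    cu≡cw = sameComponent-c (step r e)

  order′-≤ : ∀ u → c′ u ≢ X → H′.order u ≤ order u
  order′-≤ u c′u≢X = begin
    H′.order u               ≤⟨ order≤classSize c′ u ⟩
    classSize c′ (c′ u)      ≤⟨ classSize-≤ (c′ u) c′u≢X ⟩
    classSize c (c′ u)       ≡⟨ cong (classSize c) (c′-other u≢v) ⟩
    classSize c (c u)        ≡⟨ classSize-order u ⟩
    order u ∎
    where
    open ≤-Reasoning
    u≢v : u ≢ v
    u≢v refl = c′u≢X c′-v

  order′-unchanged : ∀ u → c u ≢ X → c u ≢ Y → H′.order u ≡ order u
  order′-unchanged u cu≢X cu≢Y = count-cong λ w →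
    mk⇔ (λ r′ → dec-true (reach? u w) (to w (dec-true⁻ (H′.reach? u w) r′)))
        (λ r → dec-true (H′.reach? u w) (Reach-outside-Y cu≢Y (dec-true⁻ (reach? u w) r)))
    where
    c′u≡cu : c′ u ≡ c u
    c′u≡cu = c′-other (≢Y⇒≢v cu≢Y)
    to : ∀ w → Reach H′ u w → Reach H u w
    to w r′ with w ≟ v
    ... | yes refl = contradiction (trans (sym c′u≡cu) (trans (⟪⟫-Reach c′ r′) c′-v)) cu≢X
    ... | no w≢v = c-sameComponent (trans (sym c′u≡cu) (trans (⟪⟫-Reach c′ r′) (c′-other w≢v)))

  module Joined (w₀ : Fin n) (cw₀≡X : c w₀ ≡ X) (pw₀≢pv : part G w₀ ≢ part G v) where

    w₀≢v : w₀ ≢ v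
    w₀≢v refl = X≢Y (trans (sym cw₀≡X) cv≡Y)

    Reach-w₀ : ∀ u → c′ u ≡ X → Reach H′ u w₀
    Reach-w₀ u c′u≡X with u ≟ v
    ... | yes refl = step here (⟪⟫-adj c′ (trans c′-v (sym (trans (c′-other w₀≢v) cw₀≡X))) (pw₀≢pv ∘ sym))
    ... | no _ = Reach-outside-Y (λ cu≡Y → X≢Y (trans (sym c′u≡X) cu≡Y)) (c-sameComponent (trans c′u≡X (sym cw₀≡X)))

    order′-X : ∀ u → c′ u ≡ X → H′.order u ≡ suc (classSize c X)
    order′-X u c′u≡X = trans (count-cong λ w →
      mk⇔ (λ r′ → trans (cong (_≡ᵇ X) (sym (trans (sym c′u≡X) (⟪⟫-Reach c′ (dec-true⁻ (H′.reach? u w) r′)))))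
                        (≡ᵇ-refl X))
          (λ c′w≡X → dec-true (H′.reach? u w)
                       (H′.Reach-trans (Reach-w₀ u c′u≡X) (H′.Reach-sym (Reach-w₀ w (≡ᵇ⇒≡ c′w≡X))))))
      (trans (sym (classSize-count c′ X)) classSize-X)

module MainArgument {n} {G : CompleteMultipartite n} (k≥2 : 2 ≤ k G) {q} (q≤n∸1 : q ≤ n ∸ 1)
                    (H : SpanningSubgraph G) {xs} (isq : IsSeq H xs) (H∈M : InM q H) where
  open SeqFacts H isq
  open ClassGraph G
  open Parts G c using (crossDegree; averaging)

  two-parts : ∃[ u ] ∃[ v ] part G u ≢ part G v
  two-parts with part-surj G (fromℕ< (≤-trans (s≤s z≤n) k≥2)) | part-surj G (fromℕ< k≥2)
  ... | u , pu | v , pv = u , v , λ pu≡pv →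
    0≢1+n (trans (sym (toℕ-fromℕ< _)) (trans (cong toℕ (trans (sym pu) (trans pu≡pv pv))) (toℕ-fromℕ< k≥2)))

  q<n : q < n
  q<n = ∸1-< (≤-trans (s≤s z≤n) (toℕ<n (proj₁ two-parts))) q≤n∸1
    where
    ∸1-< : ∀ {m} → 1 ≤ m → q ≤ m ∸ 1 → q < m
    ∸1-< {suc m} _ q≤m = s≤s q≤m

  -- H is disconnected with or₁ + or₂ ≤ q < n, so it has a third component.
  three-components : ∃[ A ] ∃[ B ] ∃[ C ] ∃[ r ] xs ≡ A ∷ B ∷ C ∷ r × A + B ≤ q
  three-components with proj₁ H∈M
  ... | ys , isy , A , B , R , ys≡ , A+B≤q with R | trans (IsSeq-unique isq isy) ys≡
  ...   | C ∷ r | xs≡ = A , B , C , r , xs≡ , A+B≤q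
  ...   | [] | xs≡ = contradiction (≤-trans (≤-reflexive n≡A+B) A+B≤q) (<⇒≱ q<n)
    where
    n≡A+B : n ≡ A + B
    n≡A+B = trans (sym tailMass-zero)
                  (trans (cong (tailMass 0) xs≡) (cong₂ _+_ (+-identityʳ A) (trans (+-identityʳ _) (+-identityʳ B))))

  Or₁Maximal : Set
  Or₁Maximal = ∀ (H′ : SpanningSubgraph G) ys → IsSeq H′ ys → InM q H′ → or₁ ys ≤ or₁ xs

  LexMaximal : Set
  LexMaximal = ∀ (H′ : SpanningSubgraph G) ys → IsSeq H′ ys → InM q H′ → xs ⪰ ys

  InM-by-edges : ∀ H′ → InS q H′ → edges H ≤ edges H′ → InM q H′
  InM-by-edges H′ H′∈S H≤H′ = H′∈S , λ H″ H″∈S → ≤-trans (proj₂ H∈M H″ H″∈S) H≤H′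

  -- Moving v from Y to X loses no edge (degree≤), and w₀ keeps v connected to X.
  record Relocation (X Y : Fin s) : Set where
    field
      X≢Y : X ≢ Y
      v w₀ : Fin n
      cv≡Y : c v ≡ Y
      cw₀≡X : c w₀ ≡ X
      pw₀≢pv : part G w₀ ≢ part G v
      degree≤ : crossDegree v Y ≤ crossDegree v X

  relocation : ∀ {X Y} → X ≢ Y → classSize c Y ≤ classSize c X → 2 ≤ classSize c X → Relocation X Y
  relocation {X} {Y} X≢Y Y≤X 2≤X with c-surjective Y
  ... | u , cu≡Y with averaging X Y u cu≡Y Y≤X
  ...   | v , cv≡Y , degree≤ with component-leaves-part X 2≤X (part G v)
  ...     | w₀ , cw₀≡X , pw₀≢pv = record
    { X≢Y = X≢Y ; v = v ; w₀ = w₀ ; cv≡Y = cv≡Y ; cw₀≡X = cw₀≡X ; pw₀≢pv = pw₀≢pv ; degree≤ = degree≤ }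

  module TopThreeComponents {A B C r} (xs≡ : xs ≡ A ∷ B ∷ C ∷ r) (A+B≤q : A + B ≤ q) where
    open TopThree (topThree (classSize c) (subst Sorted xs-tabulate xs-sorted) A B C r (trans (sym xs-tabulate) xs≡))

    B≤A : B ≤ A
    B≤A = subst (_≤ A) g-L₁ (≤a L₁)

    C≤B : C ≤ B
    C≤B = subst (_≤ B) g-L₂ (≤b L₂ (L₀≢L₂ ∘ sym))

    A+C≤q : A + C ≤ q
    A+C≤q = ≤-trans (+-monoʳ-≤ A C≤B) A+B≤q

    class≤q : ∀ ℓ → classSize c ℓ ≤ q
    class≤q ℓ = ≤-trans (≤a ℓ) (≤-trans (m≤m+n A B) A+B≤q)

    two-classes≤q : ∀ ℓ ℓ′ → ℓ ≢ ℓ′ → classSize c ℓ + classSize c ℓ′ ≤ q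
    two-classes≤q ℓ ℓ′ ℓ≢ℓ′ with ℓ ≟ L₀
    ... | yes refl = ≤-trans (+-mono-≤ (≤a ℓ) (≤b ℓ′ (ℓ≢ℓ′ ∘ sym))) A+B≤q
    ... | no ℓ≢L₀ = ≤-trans (+-mono-≤ (≤b ℓ ℓ≢L₀) (≤a ℓ′)) (≤-trans (≤-reflexive (+-comm B A)) A+B≤q)

    module Relocated {X Y} (ρ : Relocation X Y) where
      open Relocation ρ public
      open Move H isq X Y X≢Y v cv≡Y public
      open Joined w₀ cw₀≡X pw₀≢pv public
      open ComponentSequence H′ using (componentSeq; componentSeq-IsSeq) public

      H′∈M : suc (classSize c X) ≤ q → (∀ ℓ → ℓ ≢ X → suc (classSize c X) + classSize c′ ℓ ≤ q) →
             ∀ L → L ≢ X → L ≢ Y → InM q H′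
      H′∈M X′≤q X′+ℓ≤q L L≢X L≢Y with c-surjective L
      ... | u , cu≡L = InM-by-edges H′ (⟪⟫-InS c′ q one≤q two≤q v u c′v≢c′u) (edges-≤ degree≤)
        where
        c′v≢c′u : c′ v ≢ c′ u
        c′v≢c′u eq = L≢X (trans (sym cu≡L)
                           (trans (sym (c′-other (≢Y⇒≢v (L≢Y ∘ trans (sym cu≡L))))) (trans (sym eq) c′-v)))
        one≤q : ∀ ℓ → classSize c′ ℓ ≤ q
        one≤q ℓ with ℓ ≟ X
        ... | yes refl = subst (_≤ q) (sym classSize-X) X′≤q
        ... | no ℓ≢X = ≤-trans (classSize-≤ ℓ ℓ≢X) (class≤q ℓ)
        two≤q : ∀ ℓ ℓ′ → ℓ ≢ ℓ′ → classSize c′ ℓ + classSize c′ ℓ′ ≤ q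
        two≤q ℓ ℓ′ ℓ≢ℓ′ with ℓ ≟ X | ℓ′ ≟ X
        ... | yes refl | _ = subst (λ t → t + classSize c′ ℓ′ ≤ q) (sym classSize-X) (X′+ℓ≤q ℓ′ (ℓ≢ℓ′ ∘ sym))
        ... | no _ | yes refl = subst (λ t → classSize c′ ℓ + t ≤ q) (sym classSize-X)
                                  (≤-trans (≤-reflexive (+-comm (classSize c′ ℓ) _)) (X′+ℓ≤q ℓ ℓ≢ℓ′))
        ... | no ℓ≢X | no ℓ′≢X = ≤-trans (+-mono-≤ (classSize-≤ ℓ ℓ≢X) (classSize-≤ ℓ′ ℓ′≢X)) (two-classes≤q ℓ ℓ′ ℓ≢ℓ′)

      order≤X : classSize c Y ≤ classSize c X → ∀ u → c′ u ≡ X → order u ≤ classSize c X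
      order≤X Y≤X u c′u≡X with u ≟ v
      ... | yes refl = ≤-trans (≤-reflexive (trans (sym (classSize-order u)) (cong (classSize c) cv≡Y))) Y≤X
      ... | no _ = ≤-reflexive (trans (sym (classSize-order u)) (cong (classSize c) c′u≡X))

      unchanged-above-Y : ∀ w → classSize c Y < w → ∀ u → c′ u ≢ X → ⟦ w ≤ᵇ order u ⟧ ≡ ⟦ w ≤ᵇ H′.order u ⟧
      unchanged-above-Y w Y<w u c′u≢X with c u ≟ Y
      ... | yes cu≡Y = cong ⟦_⟧ (trans (≤ᵇ-false order<w) (sym (≤ᵇ-false (≤-<-trans (order′-≤ u c′u≢X) order<w))))
        where
        order<w : order u < w
        order<w = subst (_< w) (trans (cong (classSize c) (sym cu≡Y)) (classSize-order u)) Y<w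
      ... | no cu≢Y = cong (λ t → ⟦ w ≤ᵇ t ⟧) (sym (order′-unchanged u (c′u≢X ∘ trans (c′-other (≢Y⇒≢v cu≢Y))) cu≢Y))

      tailMass-above : classSize c Y ≤ classSize c X → ∀ w → suc (classSize c X) < w →
                       tailMass w xs ≡ tailMass w componentSeq
      tailMass-above Y≤X w X<w =
        trans (tailMass-count w) (trans (sum-cong-≗ pointwise) (sym (SeqFacts.tailMass-count H′ componentSeq-IsSeq w)))
        where
        pointwise : ∀ u → ⟦ w ≤ᵇ order u ⟧ ≡ ⟦ w ≤ᵇ H′.order u ⟧
        pointwise u with c′ u ≟ X
        ... | yes c′u≡X = cong ⟦_⟧ (trans (≤ᵇ-false (≤-<-trans (order≤X Y≤X u c′u≡X) (<-trans (n<1+n _) X<w)))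
                                          (sym (≤ᵇ-false (subst (_< w) (sym (order′-X u c′u≡X)) X<w))))
        ... | no c′u≢X = unchanged-above-Y w (≤-<-trans Y≤X (<-trans (n<1+n _) X<w)) u c′u≢X

      tailMass-at : classSize c Y ≤ classSize c X → tailMass (suc (classSize c X)) xs < tailMass (suc (classSize c X)) componentSeq
      tailMass-at Y≤X = subst₂ _<_ (sym (tailMass-count _)) (sym (SeqFacts.tailMass-count H′ componentSeq-IsSeq _))
                                   (∑-mono-< pointwise v at-v)
        where
        below : ∀ u → c′ u ≡ X → (suc (classSize c X) ≤ᵇ order u) ≡ false
        below u c′u≡X = ≤ᵇ-false (s≤s (order≤X Y≤X u c′u≡X))
        pointwise : ∀ u → ⟦ suc (classSize c X) ≤ᵇ order u ⟧ ≤ ⟦ suc (classSize c X) ≤ᵇ H′.order u ⟧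
        pointwise u with c′ u ≟ X
        ... | yes c′u≡X = subst (_≤ _) (cong ⟦_⟧ (sym (below u c′u≡X))) z≤n
        ... | no c′u≢X = ≤-reflexive (unchanged-above-Y _ (s≤s Y≤X) u c′u≢X)
        at-v : ⟦ suc (classSize c X) ≤ᵇ order v ⟧ < ⟦ suc (classSize c X) ≤ᵇ H′.order v ⟧
        at-v = subst₂ (λ a b → ⟦ a ⟧ < ⟦ b ⟧) (sym (below v c′-v)) (sym (≤ᵇ-true (≤-reflexive (sym (order′-X v c′-v)))))
                      (s≤s z≤n)

    -- Relocating a vertex into a largest class would create a component of order A + 1.
    no-growth : Or₁Maximal → A + C < q → ∀ {X Y} → Relocation X Y →
                classSize c X ≡ A → classSize c Y ≤ B → (∀ ℓ → ℓ ≢ X → ℓ ≢ Y → classSize c ℓ ≤ C) → ⊥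
    no-growth or₁-max A+C<q {X} {Y} ρ X≡A Y≤B others≤C with third X Y
    ... | L , L≢X , L≢Y = <-irrefl (sym (cong or₁ xs≡)) A<or₁
      where
      open Relocated ρ
      X′+ℓ≤q : ∀ ℓ → ℓ ≢ X → suc (classSize c X) + classSize c′ ℓ ≤ q
      X′+ℓ≤q ℓ ℓ≢X rewrite X≡A with ℓ ≟ Y
      ... | yes refl = ≤-trans (≤-reflexive (trans (sym (+-suc A _)) (cong (A +_) classSize-Y)))
                               (≤-trans (+-monoʳ-≤ A Y≤B) A+B≤q)
      ... | no ℓ≢Y = ≤-trans (+-monoʳ-≤ (suc A) (≤-trans (≤-reflexive (classSize-other ℓ ℓ≢X ℓ≢Y)) (others≤C ℓ ℓ≢X ℓ≢Y)))
                             A+C<q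
      H′∈M′ : InM q H′
      H′∈M′ = H′∈M (≤-trans (s≤s (≤-trans (≤-reflexive X≡A) (m≤m+n A C))) A+C<q) X′+ℓ≤q L L≢X L≢Y
      A<or₁ : A < or₁ xs
      A<or₁ = begin-strict
        A                           <⟨ n<1+n A ⟩
        suc A                       ≡⟨ trans (order′-X v c′-v) (cong suc X≡A) ⟨
        H′.order v                  ≤⟨ SeqFacts.order≤or₁ H′ componentSeq-IsSeq v ⟩
        or₁ componentSeq            ≤⟨ or₁-max H′ componentSeq componentSeq-IsSeq H′∈M′ ⟩
        or₁ xs                      ∎
        where open ≤-Reasoning

    relocation-into-largest : ∃[ X ] ∃[ Y ] Relocation X Y × classSize c X ≡ A × classSize c Y ≤ B ×
                              (∀ ℓ → ℓ ≢ X → ℓ ≢ Y → classSize c ℓ ≤ C)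
    relocation-into-largest with 2 ≤? A
    ... | yes 2≤A = L₀ , L₁ , relocation L₀≢L₁ (subst (classSize c L₁ ≤_) (sym g-L₀) (≤a L₁)) (subst (2 ≤_) (sym g-L₀) 2≤A) ,
                    g-L₀ , ≤-reflexive g-L₁ , ≤c
    ... | no A≱2 = X , Y , ρ , ≤-antisym (≤a X) (subst (_≤ classSize c X) (sym A≡1) (classSize-pos X)) ,
                   ≤-trans (at-most-1 Y) (subst (1 ≤_) g-L₁ (classSize-pos L₁)) ,
                   λ ℓ _ _ → ≤-trans (at-most-1 ℓ) (subst (1 ≤_) g-L₂ (classSize-pos L₂))
      where
      A≡1 : A ≡ 1
      A≡1 = ≤-antisym (≤-pred (≰⇒> A≱2)) (subst (1 ≤_) g-L₀ (classSize-pos L₀))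
      at-most-1 : ∀ ℓ → classSize c ℓ ≤ 1
      at-most-1 ℓ = subst (classSize c ℓ ≤_) A≡1 (≤a ℓ)
      u₀ = proj₁ two-parts
      v₀ = proj₁ (proj₂ two-parts)
      X = c u₀
      Y = c v₀
      X≢Y : X ≢ Y
      X≢Y cu₀≡cv₀ = proj₂ (proj₂ two-parts) (cong (part G) (singleton-class Y (at-most-1 Y) cu₀≡cv₀ refl))
      ρ : Relocation X Y
      ρ with averaging X Y v₀ refl (≤-trans (at-most-1 Y) (classSize-pos X))
      ... | v , cv≡Y , degree≤ with singleton-class Y (at-most-1 Y) cv≡Y refl
      ...   | refl = record { X≢Y = X≢Y ; v = v₀ ; w₀ = u₀ ; cv≡Y = refl ; cw₀≡X = refl
                            ; pw₀≢pv = proj₂ (proj₂ two-parts) ; degree≤ = degree≤ }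

    q≤A+C : Or₁Maximal → q ≤ A + C
    q≤A+C or₁-max = ≮⇒≥ λ A+C<q →
      let (X , Y , ρ , X≡A , Y≤B , others≤C) = relocation-into-largest in no-growth or₁-max A+C<q ρ X≡A Y≤B others≤C

    -- Moving a vertex from the z′-component into the z-component would raise seq lexicographically.
    no-dip : LexMaximal → Dip B xs → ⊥
    no-dip lex-max (pre , z , z′ , post , xs≡′ , z′≤z , 2≤z , z<B)
      with tabulate-adjacent (classSize c) pre z z′ post (trans (sym xs-tabulate) xs≡′)
    ... | X , Y , X≢Y , X≡z , Y≡z′ =
      <⇒≱ (tailMass-at Y≤X) (⪰⇒tailMass-≥ xs⪰ys xs-sorted (SeqFacts.xs-sorted H′ componentSeq-IsSeq) _ (tailMass-above Y≤X))
      where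
      Y≤X : classSize c Y ≤ classSize c X
      Y≤X = subst₂ _≤_ (sym Y≡z′) (sym X≡z) z′≤z
      open Relocated (relocation X≢Y Y≤X (subst (2 ≤_) (sym X≡z) 2≤z))
      X<B : classSize c X < B
      X<B = subst (_< B) (sym X≡z) z<B
      X≢L₀ : X ≢ L₀
      X≢L₀ refl = <-irrefl g-L₀ (<-≤-trans X<B B≤A)
      Y≢L₀ : Y ≢ L₀
      Y≢L₀ refl = <-irrefl g-L₀ (≤-<-trans Y≤X (<-≤-trans X<B B≤A))
      X′+ℓ≤q : ∀ ℓ → ℓ ≢ X → suc (classSize c X) + classSize c′ ℓ ≤ q
      X′+ℓ≤q ℓ ℓ≢X = ≤-trans (+-mono-≤ X<B (≤-trans (classSize-≤ ℓ ℓ≢X) (≤a ℓ))) (≤-trans (≤-reflexive (+-comm B A)) A+B≤q)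
      xs⪰ys : xs ⪰ componentSeq
      xs⪰ys = lex-max H′ componentSeq componentSeq-IsSeq
                (H′∈M (≤-trans X<B (≤-trans (m≤n+m B A) A+B≤q)) X′+ℓ≤q L₀ (X≢L₀ ∘ sym) (Y≢L₀ ∘ sym))

  or₁+or₃≡q : Or₁Maximal → ∃[ A ] ∃[ B ] ∃[ C ] ∃[ r ] xs ≡ A ∷ B ∷ C ∷ r × A + C ≡ q
  or₁+or₃≡q or₁-max with three-components
  ... | A , B , C , r , xs≡ , A+B≤q = A , B , C , r , xs≡ , ≤-antisym A+C≤q (q≤A+C or₁-max)
    where open TopThreeComponents xs≡ A+B≤q

  shapes : Or₁Maximal → LexMaximal → ShapeA xs ⊎ ShapeB xs
  shapes or₁-max lex-max with three-components
  ... | A , B , C , r , xs≡ , A+B≤q = classify (trans xs≡ (cong (λ t → A ∷ B ∷ t ∷ r) (sym B≡C)))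
    where
    open TopThreeComponents xs≡ A+B≤q
    B≡C : B ≡ C
    B≡C = ≤-antisym (+-cancelˡ-≤ A B C (≤-trans A+B≤q (q≤A+C or₁-max))) C≤B
    classify : xs ≡ A ∷ B ∷ B ∷ r → ShapeA xs ⊎ ShapeB xs
    classify xs≡′ with shape A B r (subst Sorted xs≡′ xs-sorted) (Allₚ.drop⁺ 3 (subst (All (1 ≤_)) xs≡′ xs-positive))
    ... | inj₁ shapeA = inj₁ (subst ShapeA (sym xs≡′) shapeA)
    ... | inj₂ (inj₁ shapeB) = inj₂ (subst ShapeB (sym xs≡′) shapeB)
    ... | inj₂ (inj₂ dip) = ⊥-elim (no-dip lex-max (subst (Dip B) (sym xs≡′) dip))

theorem3p5 : ∀ (n : ℕ) (G : CompleteMultipartite n) → 2 ≤ k G →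
    ∀ (q : ℕ) → 2 ≤ q → q ≤ n ∸ 1 →
    ∀ (H : SpanningSubgraph G) (xs : List ℕ) → IsSeq H xs → InM q H →
    (∀ (H' : SpanningSubgraph G) (ys : List ℕ) → IsSeq H' ys → InM q H' → or₁ ys ≤ or₁ xs) →
    (Σ ℕ λ a → Σ ℕ λ b → Σ ℕ λ c → Σ (List ℕ) λ r → (xs ≡ a ∷ b ∷ c ∷ r) × (a + c ≡ q))
    × ((∀ (H' : SpanningSubgraph G) (ys : List ℕ) → IsSeq H' ys → InM q H' → xs ⪰ ys) →
       ShapeA xs ⊎ ShapeB xs)
theorem3p5 n G k≥2 q _ q≤n∸1 H xs isq H∈M or₁-max = or₁+or₃≡q or₁-max , shapes or₁-max
  where open MainArgument k≥2 q≤n∸1 H isq H∈M
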